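{- (a) For every prime power $q>3$, $g(\Lambda_{5,q})=10$. (b) $g(\Lambda_{5,3})\ge12$.
   Context: For a prime power $q$ and integer $k\ge2$, $\Lambda_{k,q}$ is the bipartite graph with vertex set $L_k\cup R_k$ (regarded as disjoint), where $L_k$ is the set of vectors $(l_0,\dots,l_k)\in\mathbb{F}_q^{k+1}$ with $l_1=l_2$ and $R_k$ the set of vectors $(r_0,\dots,r_k)\in\mathbb{F}_q^{k+1}$ with $r_1=0$; edges join only $L_k$ to $R_k$, and $(l_0,\dots,l_k)\sim(r_0,\dots,r_k)$ iff for every $2\le i\le k$: $l_i+r_i=r_0l_{i-2}$ if $i\equiv2,3\pmod4$, and $l_i+r_i=l_0r_{i-2}$ if $i\equiv0,1\pmod4$. $g(G)$ denotes the girth (length of a shortest cycle) of $G$. -}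

module Defs where

open import Level using (0ℓ)
open import Data.Nat using (ℕ; zero; suc; _≤_; _<_; _∸_; _^_; _%_)
open import Data.Nat.Properties using (≤-trans; m∸n≤m)
open import Data.Nat.Primality using (Prime)
open import Data.Fin using (Fin; zero; suc; fromℕ<; fromℕ; inject₁)
open import Data.Vec using (Vec; lookup)
open import Data.Product using (Σ; ∃; ∃-syntax; _×_; _,_)
open import Data.Sum using (_⊎_)
open import Data.Empty using (⊥)
open import Relation.Nullary using (¬_)
open import Relation.Binary.PropositionalEquality using (_≡_)
open import Algebra.Core using (Op₁; Op₂)
open import Algebra.Structures using (IsCommutativeRing)
open import Function.Bundles using (_↔_)

IsPrimePower : ℕ → Set
IsPrimePower q = ∃[ p ] ∃[ k ] (Prime p × 1 ≤ k × q ≡ p ^ k)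

record FiniteField (q : ℕ) : Set₁ where
  field
    Carrier : Set
    _+_ : Op₂ Carrier
    _*_ : Op₂ Carrier
    -_  : Op₁ Carrier
    0# : Carrier
    1# : Carrier
    isCommutativeRing : IsCommutativeRing _≡_ _+_ _*_ -_ 0# 1#
    0≢1 : ¬ (0# ≡ 1#)
    inverse : ∀ x → ¬ (x ≡ 0#) → ∃[ y ] (x * y ≡ 1#)
    card : Carrier ↔ Fin q

record Graph : Set₁ where
  field
    V   : Set
    Adj : V → V → Set

record Cycle (G : Graph) (n : ℕ) : Set where
  open Graph G
  field
    m       : ℕ
    n≡1+m   : n ≡ suc m
    3≤n     : 3 ≤ n
    vertex  : Fin (suc m) → V
    distinct : ∀ i j → vertex i ≡ vertex j → i ≡ j
    step    : ∀ (i : Fin m) → Adj (vertex (inject₁ i)) (vertex (suc i))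
    close   : Adj (vertex (fromℕ m)) (vertex zero)

GirthIs : Graph → ℕ → Set
GirthIs G n = Cycle G n × (∀ l → l < n → ¬ Cycle G l)

-- g(G) ≥ n : G has no cycle of length < n (includes the acyclic case g = ∞).
GirthAtLeast : Graph → ℕ → Set
GirthAtLeast G n = ∀ l → l < n → ¬ Cycle G l

data Side : Set where
  left right : Side

module _ {q : ℕ} (F : FiniteField q) where
  open FiniteField F

  _!_ : ∀ {k} → Vec Carrier (suc k) → (i : ℕ) → i < suc k → Carrier
  (v ! i) p = lookup v (fromℕ< p)

  -- L_k : l₁ = l₂ ;  R_k : r₁ = 0   (k ≥ 2 so indices 1,2 exist)
  InL : ∀ k → 2 ≤ k → Vec Carrier (suc k) → Set
  InL (suc (suc k)) _ l = lookup l (suc zero) ≡ lookup l (suc (suc zero))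
  InL _ _ _ = ⊥

  InR : ∀ k → 2 ≤ k → Vec Carrier (suc k) → Set
  InR (suc (suc k)) _ r = lookup r (suc zero) ≡ 0#
  InR _ _ _ = ⊥

  EdgeCond : ∀ {k} → Vec Carrier (suc k) → Vec Carrier (suc k) →
             (i : ℕ) → i < suc k → Set
  EdgeCond {k} l r i p with i % 4
  ... | 2 = (l ! i) p + (r ! i) p ≡ (r ! 0) (Data.Nat.s≤s Data.Nat.z≤n) * (l ! (i ∸ 2)) (≤-trans (Data.Nat.s≤s (m∸n≤m i 2)) p)
  ... | 3 = (l ! i) p + (r ! i) p ≡ (r ! 0) (Data.Nat.s≤s Data.Nat.z≤n) * (l ! (i ∸ 2)) (≤-trans (Data.Nat.s≤s (m∸n≤m i 2)) p)
  ... | _ = (l ! i) p + (r ! i) p ≡ (l ! 0) (Data.Nat.s≤s Data.Nat.z≤n) * (r ! (i ∸ 2)) (≤-trans (Data.Nat.s≤s (m∸n≤m i 2)) p)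

  LREdge : ∀ k → 2 ≤ k → Vec Carrier (suc k) → Vec Carrier (suc k) → Set
  LREdge k h l r = InL k h l × InR k h r ×
                   (∀ i → 2 ≤ i → (p : i < suc k) → EdgeCond l r i p)

  -- vertices are tagged vectors; vectors not in L_k / R_k are never adjacent,
  -- so they lie on no cycle.
  ΛAdj : ∀ k → 2 ≤ k → Side × Vec Carrier (suc k) → Side × Vec Carrier (suc k) → Set
  ΛAdj k h (left  , l) (right , r) = LREdge k h l r
  ΛAdj k h (right , r) (left  , l) = LREdge k h l r
  ΛAdj k h _ _ = ⊥

  Λ : ∀ k → 2 ≤ k → Graph
  Λ k h = record { V = Side × Vec Carrier (suc k) ; Adj = ΛAdj k h }

-- Λ₅ is bipartite and every vertex has exactly one neighbour of each colour (its first
-- coordinate), so there are no odd cycles and a cycle of length 2k is a closed walk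
-- l₁ r₁ … l_k r_k determined by l₁ and the colours a₁ b₁ … a_k b_k, consecutive vertices on
-- one side having different colours. Walking around changes the coordinates of l₁ by
-- polynomials in the colours, so a closed walk forces X = Y = Z = W = 0 for four explicit
-- polynomials. For k ≤ 4 these have no admissible solution over any field (for k = 4 with
-- distinct colours because X = Y = 0 puts the colour differences in the kernel of a
-- Vandermonde matrix), so the girth is at least 10. Over F₃, 1 − (b − β)² is the indicator of
-- b = β, and a combination of X, Y, Z, W built from such indicators rules out k = 5 as well;
-- for q > 3 an explicit 10-cycle uses a colour c ∉ {0, 1, −1}.

module Submission where

open import Level using (Level; 0ℓ)
open import Algebra.Bundles using (CommutativeRing)
open import Data.Empty using (⊥)
open import Data.Fin using (Fin; zero; suc; toℕ; fromℕ; inject₁; #_)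
open import Data.Fin.Properties as Fin
  using (injective⇒≤; all?; ¬∀⟶∃¬; toℕ-fromℕ; fromℕ≢inject₁; inject₁-injective)
open import Data.Integer.Base as ℤ using (ℤ)
open import Data.List.Base using (List; []; _∷_)
open import Data.Nat as ℕ using (ℕ; zero; suc; _≤_; _<_; s≤s; z≤n; _≤?_; _<?_)
open import Data.Nat.Properties using (<⇒≱; n≮n; m≤n⇒m<n∨m≡n)
open import Data.Product.Base using (_×_; _,_; proj₁; proj₂; ∃-syntax)
open import Data.Sum.Base using (inj₁; inj₂)
open import Data.Vec.Base using (Vec; []; _∷_; head; lookup)
open import Data.Vec.Relation.Unary.All using (All; []; _∷_)
open import Data.Vec.Relation.Unary.AllPairs using ([]; _∷_)
open import Data.Vec.Relation.Unary.Any as Any using (here; there)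
open import Data.Vec.Relation.Unary.Any.Properties using (lookup-index)
open import Data.Vec.Relation.Unary.Unique.Propositional using (Unique)
open import Data.Vec.Relation.Unary.Unique.Propositional.Properties using (lookup-injective)
open import Function.Base using (_∘_; _∋_)
open import Function.Bundles using (_↔_; Inverse; Injection)
open import Function.Properties.Inverse using (↔⇒↣)
open import Relation.Binary.Definitions using (DecidableEquality)
open import Relation.Binary.PropositionalEquality
  using (_≡_; _≢_; refl; sym; trans; cong; cong₂; subst; subst₂; ≢-sym; module ≡-Reasoning)
open import Relation.Nullary using (¬_; yes; no)
open import Relation.Nullary.Decidable using (True; False; toWitness; toWitnessFalse; map′)
open import Relation.Nullary.Negation using (contradiction)
open import Tactic.RingSolver.Core.Expression using (Expr; Κ; Ι; _⊕_; _⊗_; _⊛_; ⊝_)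

open import Defs

-- The solvers of the standard library take their coefficients from the ring itself, so over an
-- abstract field they cannot cancel x - x; with coefficients in ℤ the normal forms compute.
module IntegerCoefficients {c ℓ : Level} (R : CommutativeRing c ℓ) where
  open import Data.Bool.Base using (Bool; true; false; T)
  open import Data.Maybe.Base using (nothing)
  open import Data.Integer.Base using (+_; -[1+_]; _⊖_; _◃_; sign; ∣_∣)
  open import Data.Integer.Properties using ([1+m]⊖[1+n]≡m⊖n)
  open import Data.Nat.Properties using (+-suc)
  open import Data.Sign.Base as Sign using (Sign)
  open import Function.Base using (_⟨_⟩_)
  open import Tactic.RingSolver.Core.AlmostCommutativeRing using (fromCommutativeRing)
  open import Tactic.RingSolver.Core.Polynomial.Parameters using (Homomorphism)
  open CommutativeRing R renaming (refl to ≈-refl; sym to ≈-sym; trans to ≈-trans)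
  open import Algebra.Properties.Ring ring using (-0#≈0#; -‿involutive; -‿distribˡ-*; -‿distribʳ-*; -‿+-comm)
  open import Algebra.Properties.Semiring.Mult.TCOptimised semiring using (×-homo-+; ×1-homo-*) renaming (_×_ to _·_)
  open import Relation.Binary.Reasoning.Setoid setoid

  ⟦_⟧ℤ : ℤ → Carrier
  ⟦ + n ⟧ℤ      = n · 1#
  ⟦ -[1+ n ] ⟧ℤ = - (suc n · 1#)

  private
    suc·1# : ∀ n → suc n · 1# ≈ 1# + n · 1#
    suc·1# = ×-homo-+ 1# 1

    1+-cancel : ∀ x y → (1# + x) + - (1# + y) ≈ x + - y
    1+-cancel x y = begin
      (1# + x) + - (1# + y)    ≈⟨ +-congˡ (-‿+-comm 1# y) ⟨
      (1# + x) + (- 1# + - y)  ≈⟨ +-assoc 1# x _ ⟩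
      1# + (x + (- 1# + - y))  ≈⟨ +-congˡ (+-congˡ (+-comm _ _)) ⟩
      1# + (x + (- y + - 1#))  ≈⟨ +-congˡ (+-assoc x _ _) ⟨
      1# + ((x + - y) + - 1#)  ≈⟨ +-comm 1# _ ⟩
      ((x + - y) + - 1#) + 1#  ≈⟨ +-assoc _ _ 1# ⟩
      (x + - y) + (- 1# + 1#)  ≈⟨ +-congˡ (-‿inverseˡ 1#) ⟩
      (x + - y) + 0#           ≈⟨ +-identityʳ _ ⟩
      x + - y                  ∎

  ⊖-homo : ∀ m n → ⟦ m ⊖ n ⟧ℤ ≈ m · 1# + - (n · 1#)
  ⊖-homo zero    zero    = ≈-sym (≈-trans (+-congˡ -0#≈0#) (+-identityʳ _))
  ⊖-homo (suc m) zero    = ≈-sym (≈-trans (+-congˡ -0#≈0#) (+-identityʳ _))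
  ⊖-homo zero    (suc n) = ≈-sym (+-identityˡ _)
  ⊖-homo (suc m) (suc n) = begin
    ⟦ suc m ⊖ suc n ⟧ℤ                  ≡⟨ cong ⟦_⟧ℤ ([1+m]⊖[1+n]≡m⊖n m n) ⟩
    ⟦ m ⊖ n ⟧ℤ                          ≈⟨ ⊖-homo m n ⟩
    m · 1# + - (n · 1#)                 ≈⟨ 1+-cancel _ _ ⟨
    (1# + m · 1#) + - (1# + n · 1#)     ≈⟨ +-cong (suc·1# m) (-‿cong (suc·1# n)) ⟨
    suc m · 1# + - (suc n · 1#)         ∎

  +-homo : ∀ i j → ⟦ i ℤ.+ j ⟧ℤ ≈ ⟦ i ⟧ℤ + ⟦ j ⟧ℤ
  +-homo (+ m)      (+ n)      = ×-homo-+ 1# m n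
  +-homo (+ m)      -[1+ n ]   = ⊖-homo m (suc n)
  +-homo -[1+ m ]   (+ n)      = ≈-trans (⊖-homo n (suc m)) (+-comm _ _)
  +-homo -[1+ m ]   -[1+ n ]   = begin
    - (suc (suc (m ℕ.+ n)) · 1#)          ≡⟨ cong (λ k → - (suc k · 1#)) (+-suc m n) ⟨
    - ((suc m ℕ.+ suc n) · 1#)            ≈⟨ -‿cong (×-homo-+ 1# (suc m) (suc n)) ⟩
    - (suc m · 1# + suc n · 1#)           ≈⟨ -‿+-comm _ _ ⟨
    - (suc m · 1#) + - (suc n · 1#)       ∎

  private
    signed : Sign → Carrier → Carrier
    signed Sign.+ x = x
    signed Sign.- x = - x

    signed-cong : ∀ s {x y} → x ≈ y → signed s x ≈ signed s y
    signed-cong Sign.+ x≈y = x≈y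
    signed-cong Sign.- x≈y = -‿cong x≈y

    signed-* : ∀ s t x y → signed (s Sign.* t) (x * y) ≈ signed s x * signed t y
    signed-* Sign.+ Sign.+ x y = ≈-refl
    signed-* Sign.+ Sign.- x y = -‿distribʳ-* x y
    signed-* Sign.- Sign.+ x y = -‿distribˡ-* x y
    signed-* Sign.- Sign.- x y = begin
      x * y          ≈⟨ -‿involutive _ ⟨
      - (- (x * y))  ≈⟨ -‿cong (-‿distribʳ-* x y) ⟩
      - (x * - y)    ≈⟨ -‿distribˡ-* x (- y) ⟩
      - x * - y      ∎

    ◃-homo : ∀ s n → ⟦ s ◃ n ⟧ℤ ≈ signed s (n · 1#)
    ◃-homo Sign.+ zero    = ≈-refl
    ◃-homo Sign.- zero    = ≈-sym -0#≈0#
    ◃-homo Sign.+ (suc n) = ≈-refl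
    ◃-homo Sign.- (suc n) = ≈-refl

    sign-abs : ∀ i → ⟦ i ⟧ℤ ≈ signed (sign i) (∣ i ∣ · 1#)
    sign-abs (+ n)      = ≈-refl
    sign-abs -[1+ n ]   = ≈-refl

  *-homo : ∀ i j → ⟦ i ℤ.* j ⟧ℤ ≈ ⟦ i ⟧ℤ * ⟦ j ⟧ℤ
  *-homo i j = begin
    ⟦ sign i Sign.* sign j ◃ ∣ i ∣ ℕ.* ∣ j ∣ ⟧ℤ
      ≈⟨ ◃-homo (sign i Sign.* sign j) (∣ i ∣ ℕ.* ∣ j ∣) ⟩
    signed (sign i Sign.* sign j) ((∣ i ∣ ℕ.* ∣ j ∣) · 1#)
      ≈⟨ signed-cong (sign i Sign.* sign j) (×1-homo-* ∣ i ∣ ∣ j ∣) ⟩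
    signed (sign i Sign.* sign j) (∣ i ∣ · 1# * ∣ j ∣ · 1#)
      ≈⟨ signed-* (sign i) (sign j) _ _ ⟩
    signed (sign i) (∣ i ∣ · 1#) * signed (sign j) (∣ j ∣ · 1#)
      ≈⟨ *-cong (sign-abs i) (sign-abs j) ⟨
    ⟦ i ⟧ℤ * ⟦ j ⟧ℤ
      ∎

  -‿homo : ∀ i → ⟦ ℤ.- i ⟧ℤ ≈ - ⟦ i ⟧ℤ
  -‿homo (+ zero)   = ≈-sym -0#≈0#
  -‿homo (+ suc n)  = ≈-refl
  -‿homo -[1+ n ]   = ≈-sym (-‿involutive _)

  private
    isZero : ℤ → Bool
    isZero (+ zero) = true
    isZero _        = false

    isZero-sound : ∀ i → T (isZero i) → 0# ≈ ⟦ i ⟧ℤ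
    isZero-sound (+ zero) _ = ≈-refl

    ℤ⟶R : Homomorphism _ _ c ℓ
    ℤ⟶R = record
      { from          = record { rawRing = ℤ.+-*-rawRing ; isZero = isZero }
      ; to            = fromCommutativeRing R (λ _ → nothing)
      ; morphism      = record
        { ⟦_⟧ = ⟦_⟧ℤ ; +-homo = +-homo ; *-homo = *-homo ; -‿homo = -‿homo
        ; 0-homo = ≈-refl ; 1-homo = ≈-refl }
      ; Zero-C⟶Zero-R = isZero-sound
      }

    open import Tactic.RingSolver.Core.Polynomial.Base (Homomorphism.from ℤ⟶R)
    open import Tactic.RingSolver.Core.Polynomial.Semantics ℤ⟶R renaming (⟦_⟧ to ⟦_⟧ₚ)
    open import Tactic.RingSolver.Core.Polynomial.Homomorphism ℤ⟶R
    open import Algebra.Properties.Semiring.Exp.TCOptimised semiring using (^-congˡ)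
    open import Tactic.RingSolver.Core.Expression using (module Eval)
    open Eval rawRing ⟦_⟧ℤ using (⟦_⟧)

    normalise : ∀ {n} → Expr ℤ n → Poly n
    normalise (Κ x)   = κ x
    normalise (Ι x)   = ι x
    normalise (x ⊕ y) = normalise x ⊞ normalise y
    normalise (x ⊗ y) = normalise x ⊠ normalise y
    normalise (⊝ x)   = ⊟ normalise x
    normalise (x ⊛ i) = normalise x ⊡ i

    ⟦_⇓⟧ : ∀ {n} → Expr ℤ n → Vec Carrier n → Carrier
    ⟦ e ⇓⟧ = ⟦ normalise e ⟧ₚ

    correct : ∀ {n} (e : Expr ℤ n) ρ → ⟦ e ⇓⟧ ρ ≈ ⟦ e ⟧ ρ
    correct (Κ x)   ρ = κ-hom x ρ
    correct (Ι x)   ρ = ι-hom x ρ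
    correct (x ⊕ y) ρ = ⊞-hom (normalise x) (normalise y) ρ ⟨ ≈-trans ⟩ +-cong (correct x ρ) (correct y ρ)
    correct (x ⊗ y) ρ = ⊠-hom (normalise x) (normalise y) ρ ⟨ ≈-trans ⟩ *-cong (correct x ρ) (correct y ρ)
    correct (⊝ x)   ρ = ⊟-hom (normalise x) ρ ⟨ ≈-trans ⟩ -‿cong (correct x ρ)
    correct (x ⊛ i) ρ = ⊡-hom (normalise x) i ρ ⟨ ≈-trans ⟩ ^-congˡ i (correct x ρ)

  open import Relation.Binary.Reflection setoid Ι ⟦_⟧ ⟦_⇓⟧ correct public using (solve)

  infix 4 _⊜_
  _⊜_ : ∀ {n} → Expr ℤ n → Expr ℤ n → Expr ℤ n × Expr ℤ n
  _⊜_ = _,_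

-- Ring syntax shared by field elements and solver expressions, so that one formula can be
-- stated about a field and handed to the solver verbatim.
record RingOperations (A : Set) : Set where
  infixl 6 _+_ _-_
  infixl 7 _*_
  infix  8 -_
  field
    _+_ _*_ : A → A → A
    -_      : A → A
    0# 1#   : A

  _-_ : A → A → A
  x - y = x + - y

open RingOperations {{...}} public

instance
  expressionOperations : ∀ {n} → RingOperations (Expr ℤ n)
  expressionOperations = record { _+_ = _⊕_ ; _*_ = _⊗_ ; -_ = ⊝_ ; 0# = Κ (ℤ.+ 0) ; 1# = Κ (ℤ.+ 1) }

module FiniteCounting {A : Set} {q : ℕ} (card : A ↔ Fin q) where
  open Inverse card using (to; from; strictlyInverseˡ)

  _≟_ : DecidableEquality A
  x ≟ y = map′ (Injection.injective (↔⇒↣ card)) (cong to) (to x Fin.≟ to y)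

  open import Data.Vec.Membership.DecPropositional _≟_ public using (_∈_; _∉_; _∈?_)

  unique⇒≤ : ∀ {k} {xs : Vec A k} → Unique xs → k ≤ q
  unique⇒≤ u = injective⇒≤ (λ {i} {j} e → lookup-injective u i j (Injection.injective (↔⇒↣ card) e))

  ∃∉ : ∀ {k} (xs : Vec A k) → k < q → ∃[ x ] x ∉ xs
  ∃∉ xs k<q with all? (λ i → from i ∈? xs)
  ... | no ¬all with i , from-i∉xs ← ¬∀⟶∃¬ q _ (λ i → from i ∈? xs) ¬all = from i , from-i∉xs
  ... | yes all∈ = contradiction (injective⇒≤ index-injective) (<⇒≱ k<q)
    where
    from-injective : ∀ {i j} → from i ≡ from j → i ≡ j
    from-injective {i} {j} e = trans (sym (strictlyInverseˡ i)) (trans (cong to e) (strictlyInverseˡ j))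
    index-injective : ∀ {i j} → Any.index (all∈ i) ≡ Any.index (all∈ j) → i ≡ j
    index-injective {i} {j} e = from-injective
      (trans (lookup-index (all∈ i)) (trans (cong (lookup xs) e) (sym (lookup-index (all∈ j)))))

  ∉⇒All≢ : ∀ {k x} {xs : Vec A k} → x ∉ xs → All (x ≢_) xs
  ∉⇒All≢ {xs = []}     x∉xs = []
  ∉⇒All≢ {xs = y ∷ ys} x∉xs = (x∉xs ∘ here) ∷ ∉⇒All≢ (x∉xs ∘ there)

  unique-full⇒∈ : {xs : Vec A q} → Unique xs → ∀ x → x ∈ xs
  unique-full⇒∈ {xs} u x with x ∈? xs
  ... | yes x∈xs = x∈xs
  ... | no  x∉xs = contradiction (unique⇒≤ (∉⇒All≢ x∉xs ∷ u)) (n≮n q)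

module Field {q : ℕ} (F : FiniteField q) where
  open FiniteField F public using (Carrier; 0≢1; inverse)
  open FiniteField F using (isCommutativeRing; card)
  open FiniteCounting card public

  ring : CommutativeRing 0ℓ 0ℓ
  ring = record { isCommutativeRing = isCommutativeRing }

  instance
    fieldOperations : RingOperations Carrier
    fieldOperations = record
      { _+_ = FiniteField._+_ F ; _*_ = FiniteField._*_ F ; -_ = FiniteField.-_ F
      ; 0# = FiniteField.0# F ; 1# = FiniteField.1# F }

  open IntegerCoefficients ring public using (solve; _⊜_)

  x*y≡0⇒y≡0 : ∀ {x y : Carrier} → x ≢ 0# → x * y ≡ 0# → y ≡ 0#
  x*y≡0⇒y≡0 {x} {y} x≢0 xy≡0 with u , xu≡1 ← inverse x x≢0 = begin
    y              ≡⟨ solve 1 (λ y → y ⊜ 1# * y) refl y ⟩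
    1# * y         ≡⟨ cong (_* y) xu≡1 ⟨
    (x * u) * y    ≡⟨ solve 3 (λ x u y → (x * u) * y ⊜ u * (x * y)) refl x u y ⟩
    u * (x * y)    ≡⟨ cong (u *_) xy≡0 ⟩
    u * 0#         ≡⟨ solve 1 (λ u → u * 0# ⊜ 0#) refl u ⟩
    0#             ∎
    where open ≡-Reasoning

  x*y≢0 : ∀ {x y : Carrier} → x ≢ 0# → y ≢ 0# → x * y ≢ 0#
  x*y≢0 x≢0 y≢0 = y≢0 ∘ x*y≡0⇒y≡0 x≢0

  -x≢0 : ∀ {x : Carrier} → x ≢ 0# → - x ≢ 0#
  -x≢0 {x} x≢0 -x≡0 = x≢0 (begin
    x          ≡⟨ solve 1 (λ x → x ⊜ - (- x)) refl x ⟩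
    - (- x)    ≡⟨ cong -_ -x≡0 ⟩
    - 0#       ≡⟨ solve 0 (- 0# ⊜ 0#) refl ⟩
    0#         ∎)
    where open ≡-Reasoning

  x-y≡0⇒x≡y : ∀ {x y : Carrier} → x - y ≡ 0# → x ≡ y
  x-y≡0⇒x≡y {x} {y} x-y≡0 = begin
    x              ≡⟨ solve 2 (λ x y → x ⊜ (x - y) + y) refl x y ⟩
    (x - y) + y    ≡⟨ cong (_+ y) x-y≡0 ⟩
    0# + y         ≡⟨ solve 1 (λ y → 0# + y ⊜ y) refl y ⟩
    y              ∎
    where open ≡-Reasoning

  x-y≢0 : ∀ {x y : Carrier} → x ≢ y → x - y ≢ 0#
  x-y≢0 x≢y = x≢y ∘ x-y≡0⇒x≡y

  x-x≡0 : ∀ (x : Carrier) → x - x ≡ 0#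
  x-x≡0 = solve 1 (λ x → x - x ⊜ 0#) refl

  1≢0 : 1# ≢ (Carrier ∋ 0#)
  1≢0 = 0≢1 ∘ sym

  x≢x+1 : ∀ (x : Carrier) → x ≢ x + 1#
  x≢x+1 x x≡x+1 = 1≢0 (begin
    1#             ≡⟨ solve 1 (λ x → 1# ⊜ (x + 1#) - x) refl x ⟩
    (x + 1#) - x   ≡⟨ cong (_- x) x≡x+1 ⟨
    x - x          ≡⟨ x-x≡0 x ⟩
    0#             ∎)
    where open ≡-Reasoning

  x≢0⇒1≢x+1 : ∀ {x : Carrier} → x ≢ 0# → 1# ≢ x + 1#
  x≢0⇒1≢x+1 {x} x≢0 1≡x+1 = x≢0 (begin
    x              ≡⟨ solve 1 (λ x → x ⊜ (x + 1#) - 1#) refl x ⟩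
    (x + 1#) - 1#  ≡⟨ cong (_- 1#) 1≡x+1 ⟨
    1# - 1#        ≡⟨ x-x≡0 1# ⟩
    0#             ∎)
    where open ≡-Reasoning

  x≢-1⇒x+1≢0 : ∀ {x : Carrier} → x ≢ - 1# → x + 1# ≢ 0#
  x≢-1⇒x+1≢0 {x} x≢-1 x+1≡0 = x≢-1 (begin
    x              ≡⟨ solve 1 (λ x → x ⊜ (x + 1#) - 1#) refl x ⟩
    (x + 1#) - 1#  ≡⟨ cong (_- 1#) x+1≡0 ⟩
    0# - 1#        ≡⟨ solve 0 (0# - 1# ⊜ - 1#) refl ⟩
    - 1#           ∎)
    where open ≡-Reasoning

-- Bipartite graphs and cycles

flip : Side → Side
flip left  = right
flip right = left

flips : ℕ → Side → Side
flips zero    s = s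
flips (suc n) s = flips n (flip s)

flip-involutive : ∀ s → flip (flip s) ≡ s
flip-involutive left  = refl
flip-involutive right = refl

flip-flips : ∀ n s → flip (flips n s) ≡ flips n (flip s)
flip-flips zero    s = refl
flip-flips (suc n) s = flip-flips n (flip s)

flips-odd : ∀ k s → flips (suc (k ℕ.* 2)) s ≢ s
flips-odd zero    left  ()
flips-odd zero    right ()
flips-odd (suc k) s rewrite flip-involutive s = flips-odd k s

module CycleRotation {G : Graph} where
  open Graph G

  private
    lastFirst : ∀ {m} → Fin (suc m) → Fin (suc m)
    lastFirst {m}     zero    = fromℕ m
    lastFirst {suc m} (suc i) = inject₁ i

    lastFirst-injective : ∀ {m} {i j : Fin (suc m)} → lastFirst i ≡ lastFirst j → i ≡ j
    lastFirst-injective {_}     {zero}  {zero}  _ = refl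
    lastFirst-injective {suc m} {zero}  {suc j} e = contradiction e fromℕ≢inject₁
    lastFirst-injective {suc m} {suc i} {zero}  e = contradiction (sym e) fromℕ≢inject₁
    lastFirst-injective {suc m} {suc i} {suc j} e = cong suc (inject₁-injective e)

    rotated-step : ∀ {m} (v : Fin (suc m) → V) → Adj (v (fromℕ m)) (v zero) →
                   (∀ i → Adj (v (inject₁ i)) (v (suc i))) →
                   ∀ i → Adj (v (lastFirst (inject₁ i))) (v (lastFirst (suc i)))
    rotated-step v close step zero    = close
    rotated-step v close step (suc i) = step (inject₁ i)

    rotated-close : ∀ {m} (v : Fin (suc m) → V) → (∀ i → Adj (v (inject₁ i)) (v (suc i))) → 3 ≤ suc m →
                    Adj (v (lastFirst (fromℕ m))) (v (lastFirst zero))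
    rotated-close {zero}  v step (s≤s ())
    rotated-close {suc m} v step _ = step (fromℕ m)

  rotate : ∀ {n} → Cycle G n → Cycle G n
  rotate c = record
    { m = m ; n≡1+m = n≡1+m ; 3≤n = 3≤n
    ; vertex   = vertex ∘ lastFirst
    ; distinct = λ i j → lastFirst-injective ∘ distinct (lastFirst i) (lastFirst j)
    ; step     = rotated-step vertex close step
    ; close    = rotated-close vertex step (subst (3 ≤_) n≡1+m 3≤n)
    }
    where open Cycle c

module Bipartite {G : Graph} (side : Graph.V G → Side)
                 (alternates : ∀ {u w} → Graph.Adj G u w → side w ≡ flip (side u)) where
  open Graph G
  open CycleRotation {G}

  side-along-path : ∀ {m} (v : Fin (suc m) → V) → (∀ i → Adj (v (inject₁ i)) (v (suc i))) →
                    ∀ i → side (v i) ≡ flips (toℕ i) (side (v zero))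
  side-along-path         v step zero    = refl
  side-along-path {suc m} v step (suc i) =
    trans (side-along-path (v ∘ suc) (step ∘ suc) i) (cong (flips (toℕ i)) (alternates (step zero)))

  noOddCycle : ∀ k → ¬ Cycle G (suc (k ℕ.* 2))
  noOddCycle k record { n≡1+m = refl ; vertex = v ; step = step ; close = close } =
    flips-odd k s₀ (begin
      flips (suc (k ℕ.* 2)) s₀                ≡⟨ flip-flips (k ℕ.* 2) s₀ ⟨
      flip (flips (k ℕ.* 2) s₀)               ≡⟨ cong (λ n → flip (flips n s₀)) (toℕ-fromℕ (k ℕ.* 2)) ⟨
      flip (flips (toℕ (fromℕ (k ℕ.* 2))) s₀) ≡⟨ cong flip (side-along-path v step (fromℕ (k ℕ.* 2))) ⟨
      flip (side (v (fromℕ (k ℕ.* 2))))       ≡⟨ alternates close ⟨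
      s₀                                      ∎)
    where
    open ≡-Reasoning
    s₀ : Side
    s₀ = side (v zero)

  noCycle-fromLeft : ∀ {n} → ((c : Cycle G n) → side (Cycle.vertex c zero) ≡ left → ⊥) → ¬ Cycle G n
  noCycle-fromLeft noLeftStart c with side (Cycle.vertex c zero) in start
  ... | left  = noLeftStart c start
  ... | right = noLeftStart (rotate c) (begin
    side (Cycle.vertex c (fromℕ (Cycle.m c)))               ≡⟨ flip-involutive _ ⟨
    flip (flip (side (Cycle.vertex c (fromℕ (Cycle.m c))))) ≡⟨ cong flip (alternates (Cycle.close c)) ⟨
    flip (side (Cycle.vertex c zero))                        ≡⟨ cong flip start ⟩
    left                                                     ∎)
    where open ≡-Reasoning

module _ {G : Graph} where

  girth≥3 : GirthAtLeast G 3
  girth≥3 l l<3 c = <⇒≱ l<3 (Cycle.3≤n c)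

  girth-step : ∀ {n} → GirthAtLeast G n → ¬ Cycle G n → GirthAtLeast G (suc n)
  girth-step girth≥n noCycle l (s≤s l≤n) with m≤n⇒m<n∨m≡n l≤n
  ... | inj₁ l<n  = girth≥n l l<n
  ... | inj₂ refl = noCycle

-- The graph Λ₅ and its closed walks

-- Vertices are coloured by their first coordinate; solving the edge equations for the other
-- endpoint shows that every vertex has exactly one neighbour of each colour, namely these.
module _ {A : Set} {{_ : RingOperations A}} where

  rightNeighbour : Vec A 6 → A → Vec A 6
  rightNeighbour (a ∷ x ∷ _ ∷ y ∷ z ∷ w ∷ []) b =
    b ∷ 0# ∷ b * a - x ∷ b * x - y ∷ a * (b * a - x) - z ∷ a * (b * x - y) - w ∷ []

  leftNeighbour : Vec A 6 → A → Vec A 6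
  leftNeighbour (b ∷ _ ∷ p ∷ s ∷ r₄ ∷ r₅ ∷ []) a =
    a ∷ b * a - p ∷ b * a - p ∷ b * (b * a - p) - s ∷ a * p - r₄ ∷ a * s - r₅ ∷ []

  hop : Vec A 6 → A → A → Vec A 6
  hop l b a = leftNeighbour (rightNeighbour l b) a

  -- A closed walk l₁ r₁ l₂ … r_k l₁ is given by the colours (aᵢ , bᵢ) of lᵢ and rᵢ; steps lists
  -- the triples (aᵢ , bᵢ , aᵢ₊₁), indices mod k.
  steps : List (A × A) → List (A × A × A)
  steps []               = []
  steps ((a₁ , b₁) ∷ cs) = go a₁ b₁ cs
    where
    go : A → A → List (A × A) → List (A × A × A)
    go a b []               = (a , b , a₁) ∷ []
    go a b ((a′ , b′) ∷ cs) = (a , b , a′) ∷ go a′ b′ cs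

  colours₂ : A → A → A → A → List (A × A)
  colours₂ a₁ b₁ a₂ b₂ = (a₁ , b₁) ∷ (a₂ , b₂) ∷ []

  colours₃ : A → A → A → A → A → A → List (A × A)
  colours₃ a₁ b₁ a₂ b₂ a₃ b₃ = (a₁ , b₁) ∷ (a₂ , b₂) ∷ (a₃ , b₃) ∷ []

  colours₄ : A → A → A → A → A → A → A → A → List (A × A)
  colours₄ a₁ b₁ a₂ b₂ a₃ b₃ a₄ b₄ = (a₁ , b₁) ∷ (a₂ , b₂) ∷ (a₃ , b₃) ∷ (a₄ , b₄) ∷ []

  colours₅ : A → A → A → A → A → A → A → A → A → A → List (A × A)
  colours₅ a₁ b₁ a₂ b₂ a₃ b₃ a₄ b₄ a₅ b₅ =
    (a₁ , b₁) ∷ (a₂ , b₂) ∷ (a₃ , b₃) ∷ (a₄ , b₄) ∷ (a₅ , b₅) ∷ []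

  walk : Vec A 6 → List (A × A) → Vec A 6
  walk l cs = go l (steps cs)
    where
    go : Vec A 6 → List (A × A × A) → Vec A 6
    go l []                  = l
    go l ((_ , b , a′) ∷ ts) = go (hop l b a′) ts

  sumOver : List (A × A × A) → (A → A → A → A) → A
  sumOver []                  f = 0#
  sumOver ((a , b , a′) ∷ ts) f = f a b a′ + sumOver ts f

  X Y Z W : List (A × A) → A
  X cs = sumOver (steps cs) λ a b a′ → b * (a′ - a)
  Y cs = sumOver (steps cs) λ a b a′ → b * b * (a′ - a)
  Z cs = sumOver (steps cs) λ a b a′ → b * (a′ * a′ - a * a)
  W cs = pairs (steps cs) + sumOver (steps cs) λ a b a′ → b * b * (a′ - a) * a′
    where
    pairs : List (A × A × A) → A
    pairs []                  = 0#
    pairs ((a , b , a′) ∷ ts) = b * (a′ - a) * sumOver ts (λ a b a′ → b * (a′ - a)) + pairs ts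

  -- How a walk changes the coordinates x, y, z, w of a left vertex (a, x, x, y, z, w), the last
  -- two corrected so that around a closed walk they become the colour polynomials X, Y, Z, W.
  shiftˣ shiftʸ shiftᶻ shiftʷ : Vec A 6 → Vec A 6 → A
  shiftˣ l l′ = lookup l′ (# 1) - lookup l (# 1)
  shiftʸ l l′ = lookup l′ (# 3) - lookup l (# 3)
  shiftᶻ l l′ = lookup l′ (# 4) - lookup l (# 4) + head l * shiftˣ l l′
  shiftʷ l l′ = lookup l′ (# 5) - lookup l (# 5) - lookup l (# 1) * shiftˣ l l′ + head l * shiftʸ l l′

  closes₂ : ∀ {l₁ l₂ : Vec A 6} {a₁ b₁ a₂ b₂} → l₂ ≡ hop l₁ b₁ a₂ → l₁ ≡ hop l₂ b₂ a₁ →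
            l₁ ≡ walk l₁ (colours₂ a₁ b₁ a₂ b₂)
  closes₂ refl closed = closed

  closes₃ : ∀ {l₁ l₂ l₃ : Vec A 6} {a₁ b₁ a₂ b₂ a₃ b₃} →
            l₂ ≡ hop l₁ b₁ a₂ → l₃ ≡ hop l₂ b₂ a₃ → l₁ ≡ hop l₃ b₃ a₁ →
            l₁ ≡ walk l₁ (colours₃ a₁ b₁ a₂ b₂ a₃ b₃)
  closes₃ refl refl closed = closed

  closes₄ : ∀ {l₁ l₂ l₃ l₄ : Vec A 6} {a₁ b₁ a₂ b₂ a₃ b₃ a₄ b₄} →
            l₂ ≡ hop l₁ b₁ a₂ → l₃ ≡ hop l₂ b₂ a₃ → l₄ ≡ hop l₃ b₃ a₄ → l₁ ≡ hop l₄ b₄ a₁ →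
            l₁ ≡ walk l₁ (colours₄ a₁ b₁ a₂ b₂ a₃ b₃ a₄ b₄)
  closes₄ refl refl refl closed = closed

  closes₅ : ∀ {l₁ l₂ l₃ l₄ l₅ : Vec A 6} {a₁ b₁ a₂ b₂ a₃ b₃ a₄ b₄ a₅ b₅} →
            l₂ ≡ hop l₁ b₁ a₂ → l₃ ≡ hop l₂ b₂ a₃ → l₄ ≡ hop l₃ b₃ a₄ → l₅ ≡ hop l₄ b₄ a₅ → l₁ ≡ hop l₅ b₅ a₁ →
            l₁ ≡ walk l₁ (colours₅ a₁ b₁ a₂ b₂ a₃ b₃ a₄ b₄ a₅ b₅)
  closes₅ refl refl refl refl closed = closed

module Λ₅ {q : ℕ} (F : FiniteField q) where
  open Field F

  2≤5 : 2 ≤ 5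
  2≤5 = s≤s (s≤s z≤n)

  Edge : Vec Carrier 6 → Vec Carrier 6 → Set
  Edge = LREdge F 5 2≤5

  edge-equation : ∀ {l r} → Edge l r → ∀ i {2≤i : True (2 ≤? i)} {i<6 : True (i <? 6)} →
                  EdgeCond F l r i (toWitness i<6)
  edge-equation (_ , _ , conditions) i {2≤i} {i<6} = conditions i (toWitness 2≤i) (toWitness i<6)

  edge-intro : ∀ {a x y z w b p s r₄ r₅ : Carrier} →
               x + p ≡ b * a → y + s ≡ b * x → z + r₄ ≡ a * p → w + r₅ ≡ a * s →
               Edge (a ∷ x ∷ x ∷ y ∷ z ∷ w ∷ []) (b ∷ 0# ∷ p ∷ s ∷ r₄ ∷ r₅ ∷ [])
  edge-intro e₂ e₃ e₄ e₅ = refl , refl , conditions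
    where
    conditions : ∀ i → 2 ≤ i → (i<6 : i < 6) → EdgeCond F _ _ i i<6
    conditions 0 () _
    conditions 1 (s≤s ()) _
    conditions 2 _ _ = e₂
    conditions 3 _ _ = e₃
    conditions 4 _ _ = e₄
    conditions 5 _ _ = e₅
    conditions (suc (suc (suc (suc (suc (suc _)))))) _ (s≤s (s≤s (s≤s (s≤s (s≤s (s≤s ()))))))

  private
    x+[y-x]≡y : ∀ (x y : Carrier) → x + (y - x) ≡ y
    x+[y-x]≡y = solve 2 (λ x y → x + (y - x) ⊜ y) refl

    [x-y]+y≡x : ∀ (x y : Carrier) → (x - y) + y ≡ x
    [x-y]+y≡x = solve 2 (λ x y → (x - y) + y ⊜ x) refl

    x+y≡z⇒y≡z-x : ∀ {x y z : Carrier} → x + y ≡ z → y ≡ z - x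
    x+y≡z⇒y≡z-x {x} {y} refl = solve 2 (λ x y → y ⊜ (x + y) - x) refl x y

    x+y≡z⇒x≡z-y : ∀ {x y z : Carrier} → x + y ≡ z → x ≡ z - y
    x+y≡z⇒x≡z-y {x} {y} refl = solve 2 (λ x y → x ⊜ (x + y) - y) refl x y

  rightNeighbour-edge : ∀ {l} b → InL F 5 2≤5 l → Edge l (rightNeighbour l b)
  rightNeighbour-edge {a ∷ x ∷ _ ∷ y ∷ z ∷ w ∷ []} b refl =
    edge-intro (x+[y-x]≡y x _) (x+[y-x]≡y y _) (x+[y-x]≡y z _) (x+[y-x]≡y w _)

  leftNeighbour-edge : ∀ {r} a → InR F 5 2≤5 r → Edge (leftNeighbour r a) r
  leftNeighbour-edge {b ∷ _ ∷ p ∷ s ∷ r₄ ∷ r₅ ∷ []} a refl =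
    edge-intro ([x-y]+y≡x _ p) ([x-y]+y≡x _ s) ([x-y]+y≡x _ r₄) ([x-y]+y≡x _ r₅)

  edge⇒rightNeighbour : ∀ {l r} → Edge l r → r ≡ rightNeighbour l (head r)
  edge⇒rightNeighbour {a ∷ x ∷ _ ∷ y ∷ z ∷ w ∷ []} {b ∷ _ ∷ p ∷ s ∷ r₄ ∷ r₅ ∷ []} e@(refl , refl , _)
    with refl ← x+y≡z⇒y≡z-x (edge-equation e 2) | refl ← x+y≡z⇒y≡z-x (edge-equation e 3)
       | refl ← x+y≡z⇒y≡z-x (edge-equation e 4) | refl ← x+y≡z⇒y≡z-x (edge-equation e 5) = refl

  edge⇒leftNeighbour : ∀ {l r} → Edge l r → l ≡ leftNeighbour r (head l)
  edge⇒leftNeighbour {a ∷ x ∷ _ ∷ y ∷ z ∷ w ∷ []} {b ∷ _ ∷ p ∷ s ∷ r₄ ∷ r₅ ∷ []} e@(refl , refl , _)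
    with refl ← x+y≡z⇒x≡z-y (edge-equation e 2) | refl ← x+y≡z⇒x≡z-y (edge-equation e 3)
       | refl ← x+y≡z⇒x≡z-y (edge-equation e 4) | refl ← x+y≡z⇒x≡z-y (edge-equation e 5) = refl

  unique-leftNeighbour : ∀ {l l′ r} → Edge l r → Edge l′ r → head l ≡ head l′ → l ≡ l′
  unique-leftNeighbour {l} {l′} {r} e e′ same = begin
    l                         ≡⟨ edge⇒leftNeighbour e ⟩
    leftNeighbour r (head l)  ≡⟨ cong (leftNeighbour r) same ⟩
    leftNeighbour r (head l′) ≡⟨ edge⇒leftNeighbour e′ ⟨
    l′                        ∎
    where open ≡-Reasoning

  unique-rightNeighbour : ∀ {l r r′} → Edge l r → Edge l r′ → head r ≡ head r′ → r ≡ r′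
  unique-rightNeighbour {l} {r} {r′} e e′ same = begin
    r                          ≡⟨ edge⇒rightNeighbour e ⟩
    rightNeighbour l (head r)  ≡⟨ cong (rightNeighbour l) same ⟩
    rightNeighbour l (head r′) ≡⟨ edge⇒rightNeighbour e′ ⟨
    r′                         ∎
    where open ≡-Reasoning

  edges⇒hop : ∀ {l r l′} → Edge l r → Edge l′ r → l′ ≡ hop l (head r) (head l′)
  edges⇒hop {l} {r} {l′} e e′ =
    trans (edge⇒leftNeighbour e′) (cong (λ r → leftNeighbour r (head l′)) (edge⇒rightNeighbour e))

  ClosedWalkEquations : List (Carrier × Carrier) → Set
  ClosedWalkEquations cs = X cs ≡ 0# × Y cs ≡ 0# × Z cs ≡ 0# × W cs ≡ 0#

  shifts-vanish : ∀ {l l′} → l ≡ l′ →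
                  shiftˣ l l′ ≡ 0# × shiftʸ l l′ ≡ 0# × shiftᶻ l l′ ≡ 0# × shiftʷ l l′ ≡ 0#
  shifts-vanish {a ∷ x ∷ _ ∷ y ∷ z ∷ w ∷ []} refl =
      x-x≡0 x
    , x-x≡0 y
    , solve 3 (λ a x z → z - z + a * (x - x) ⊜ 0#) refl a x z
    , solve 4 (λ a x y w → w - w - x * (x - x) + a * (y - y) ⊜ 0#) refl a x y w

  closedWalk₂ : ∀ l b₁ a₂ b₂ → l ≡ walk l (colours₂ (head l) b₁ a₂ b₂) →
                X (colours₂ (head l) b₁ a₂ b₂) ≡ 0#
  closedWalk₂ (a₁ ∷ x ∷ x′ ∷ y ∷ z ∷ w ∷ []) b₁ a₂ b₂ closed =
    trans (solve 9 (λ a₁ x x′ y z w b₁ a₂ b₂ →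
             let l  = a₁ ∷ x ∷ x′ ∷ y ∷ z ∷ w ∷ []
                 cs = colours₂ a₁ b₁ a₂ b₂
             in X cs ⊜ shiftˣ l (walk l cs)) refl a₁ x x′ y z w b₁ a₂ b₂)
          (proj₁ (shifts-vanish closed))

  closedWalk₃ : ∀ l b₁ a₂ b₂ a₃ b₃ → l ≡ walk l (colours₃ (head l) b₁ a₂ b₂ a₃ b₃) →
                let cs = colours₃ (head l) b₁ a₂ b₂ a₃ b₃ in X cs ≡ 0# × Y cs ≡ 0#
  closedWalk₃ (a₁ ∷ x ∷ x′ ∷ y ∷ z ∷ w ∷ []) b₁ a₂ b₂ a₃ b₃ closed
    with x-closes , y-closes , _ ← shifts-vanish closed =
      trans (solve 11 (λ a₁ x x′ y z w b₁ a₂ b₂ a₃ b₃ →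
               let l  = a₁ ∷ x ∷ x′ ∷ y ∷ z ∷ w ∷ []
                   cs = colours₃ a₁ b₁ a₂ b₂ a₃ b₃
               in X cs ⊜ shiftˣ l (walk l cs)) refl a₁ x x′ y z w b₁ a₂ b₂ a₃ b₃) x-closes
    , trans (solve 11 (λ a₁ x x′ y z w b₁ a₂ b₂ a₃ b₃ →
               let l  = a₁ ∷ x ∷ x′ ∷ y ∷ z ∷ w ∷ []
                   cs = colours₃ a₁ b₁ a₂ b₂ a₃ b₃
               in Y cs ⊜ shiftʸ l (walk l cs)) refl a₁ x x′ y z w b₁ a₂ b₂ a₃ b₃) y-closes

  closedWalk₄ : ∀ l b₁ a₂ b₂ a₃ b₃ a₄ b₄ →
                l ≡ walk l (colours₄ (head l) b₁ a₂ b₂ a₃ b₃ a₄ b₄) →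
                ClosedWalkEquations (colours₄ (head l) b₁ a₂ b₂ a₃ b₃ a₄ b₄)
  closedWalk₄ (a₁ ∷ x ∷ x′ ∷ y ∷ z ∷ w ∷ []) b₁ a₂ b₂ a₃ b₃ a₄ b₄ closed
    with x-closes , y-closes , z-closes , w-closes ← shifts-vanish closed =
      trans (solve 13 (λ a₁ x x′ y z w b₁ a₂ b₂ a₃ b₃ a₄ b₄ →
               let l  = a₁ ∷ x ∷ x′ ∷ y ∷ z ∷ w ∷ []
                   cs = colours₄ a₁ b₁ a₂ b₂ a₃ b₃ a₄ b₄
               in X cs ⊜ shiftˣ l (walk l cs)) refl a₁ x x′ y z w b₁ a₂ b₂ a₃ b₃ a₄ b₄) x-closes
    , trans (solve 13 (λ a₁ x x′ y z w b₁ a₂ b₂ a₃ b₃ a₄ b₄ →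
               let l  = a₁ ∷ x ∷ x′ ∷ y ∷ z ∷ w ∷ []
                   cs = colours₄ a₁ b₁ a₂ b₂ a₃ b₃ a₄ b₄
               in Y cs ⊜ shiftʸ l (walk l cs)) refl a₁ x x′ y z w b₁ a₂ b₂ a₃ b₃ a₄ b₄) y-closes
    , trans (solve 13 (λ a₁ x x′ y z w b₁ a₂ b₂ a₃ b₃ a₄ b₄ →
               let l  = a₁ ∷ x ∷ x′ ∷ y ∷ z ∷ w ∷ []
                   cs = colours₄ a₁ b₁ a₂ b₂ a₃ b₃ a₄ b₄
               in Z cs ⊜ shiftᶻ l (walk l cs)) refl a₁ x x′ y z w b₁ a₂ b₂ a₃ b₃ a₄ b₄) z-closes
    , trans (solve 13 (λ a₁ x x′ y z w b₁ a₂ b₂ a₃ b₃ a₄ b₄ →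
               let l  = a₁ ∷ x ∷ x′ ∷ y ∷ z ∷ w ∷ []
                   cs = colours₄ a₁ b₁ a₂ b₂ a₃ b₃ a₄ b₄
               in W cs ⊜ shiftʷ l (walk l cs)) refl a₁ x x′ y z w b₁ a₂ b₂ a₃ b₃ a₄ b₄) w-closes

  closedWalk₅ : ∀ l b₁ a₂ b₂ a₃ b₃ a₄ b₄ a₅ b₅ →
                l ≡ walk l (colours₅ (head l) b₁ a₂ b₂ a₃ b₃ a₄ b₄ a₅ b₅) →
                ClosedWalkEquations (colours₅ (head l) b₁ a₂ b₂ a₃ b₃ a₄ b₄ a₅ b₅)
  closedWalk₅ (a₁ ∷ x ∷ x′ ∷ y ∷ z ∷ w ∷ []) b₁ a₂ b₂ a₃ b₃ a₄ b₄ a₅ b₅ closed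
    with x-closes , y-closes , z-closes , w-closes ← shifts-vanish closed =
      trans (solve 15 (λ a₁ x x′ y z w b₁ a₂ b₂ a₃ b₃ a₄ b₄ a₅ b₅ →
               let l  = a₁ ∷ x ∷ x′ ∷ y ∷ z ∷ w ∷ []
                   cs = colours₅ a₁ b₁ a₂ b₂ a₃ b₃ a₄ b₄ a₅ b₅
               in X cs ⊜ shiftˣ l (walk l cs)) refl a₁ x x′ y z w b₁ a₂ b₂ a₃ b₃ a₄ b₄ a₅ b₅) x-closes
    , trans (solve 15 (λ a₁ x x′ y z w b₁ a₂ b₂ a₃ b₃ a₄ b₄ a₅ b₅ →
               let l  = a₁ ∷ x ∷ x′ ∷ y ∷ z ∷ w ∷ []
                   cs = colours₅ a₁ b₁ a₂ b₂ a₃ b₃ a₄ b₄ a₅ b₅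
               in Y cs ⊜ shiftʸ l (walk l cs)) refl a₁ x x′ y z w b₁ a₂ b₂ a₃ b₃ a₄ b₄ a₅ b₅) y-closes
    , trans (solve 15 (λ a₁ x x′ y z w b₁ a₂ b₂ a₃ b₃ a₄ b₄ a₅ b₅ →
               let l  = a₁ ∷ x ∷ x′ ∷ y ∷ z ∷ w ∷ []
                   cs = colours₅ a₁ b₁ a₂ b₂ a₃ b₃ a₄ b₄ a₅ b₅
               in Z cs ⊜ shiftᶻ l (walk l cs)) refl a₁ x x′ y z w b₁ a₂ b₂ a₃ b₃ a₄ b₄ a₅ b₅) z-closes
    , trans (solve 15 (λ a₁ x x′ y z w b₁ a₂ b₂ a₃ b₃ a₄ b₄ a₅ b₅ →
               let l  = a₁ ∷ x ∷ x′ ∷ y ∷ z ∷ w ∷ []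
                   cs = colours₅ a₁ b₁ a₂ b₂ a₃ b₃ a₄ b₄ a₅ b₅
               in W cs ⊜ shiftʷ l (walk l cs)) refl a₁ x x′ y z w b₁ a₂ b₂ a₃ b₃ a₄ b₄ a₅ b₅) w-closes

-- Closed walks of length 4, 6 and 8

module _ {A : Set} {{_ : RingOperations A}} where

  -- If b₁, …, b₄ are distinct, X = Y = 0 and the telescoping Σ (aᵢ₊₁ − aᵢ) = 0 make the colour
  -- differences a multiple of the signed 3 × 3 minors of the Vandermonde matrix of b₁, …, b₄.
  V₁ V₂ V₃ : A → A → A → A → A
  V₁ b₁ b₂ b₃ b₄ = - ((b₃ - b₂) * (b₄ - b₂) * (b₄ - b₃))
  V₂ b₁ b₂ b₃ b₄ = (b₃ - b₁) * (b₄ - b₁) * (b₄ - b₃)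
  V₃ b₁ b₂ b₃ b₄ = - ((b₂ - b₁) * (b₄ - b₁) * (b₄ - b₂))

  vandermonde : A → A → A → A → A
  vandermonde b₁ b₂ b₃ b₄ = (b₂ - b₁) * (b₃ - b₁) * (b₄ - b₁) * (b₃ - b₂) * (b₄ - b₂) * (b₄ - b₃)

  kernelWalk : A → A → A → A → A → A → List (A × A)
  kernelWalk a₁ μ b₁ b₂ b₃ b₄ =
      (a₁ , b₁)
    ∷ (a₁ + μ * V₁ b₁ b₂ b₃ b₄ , b₂)
    ∷ (a₁ + μ * V₁ b₁ b₂ b₃ b₄ + μ * V₂ b₁ b₂ b₃ b₄ , b₃)
    ∷ (a₁ + μ * (V₁ b₁ b₂ b₃ b₄ + V₂ b₁ b₂ b₃ b₄ + V₃ b₁ b₂ b₃ b₄) , b₄)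
    ∷ []

module ClosedWalkColours {q : ℕ} (F : FiniteField q) where
  open Field F
  open Λ₅ F using (ClosedWalkEquations) public

  combination≡0 : ∀ {P Q : Carrier} s t → P ≡ 0# → Q ≡ 0# → s * P + t * Q ≡ 0#
  combination≡0 s t refl refl = solve 2 (λ s t → s * 0# + t * 0# ⊜ 0#) refl s t

  unsolvable₂ : ∀ a₁ b₁ a₂ b₂ → X (colours₂ a₁ b₁ a₂ b₂) ≡ 0# → a₁ ≢ a₂ → b₁ ≢ b₂ → ⊥
  unsolvable₂ a₁ b₁ a₂ b₂ X≡0 a₁≢a₂ b₁≢b₂ =
    x*y≢0 (x-y≢0 b₁≢b₂) (x-y≢0 (≢-sym a₁≢a₂)) (trans
      (solve 4 (λ a₁ b₁ a₂ b₂ → (b₁ - b₂) * (a₂ - a₁) ⊜ X (colours₂ a₁ b₁ a₂ b₂)) refl a₁ b₁ a₂ b₂)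
      X≡0)

  unsolvable₃ : ∀ a₁ b₁ a₂ b₂ a₃ b₃ → let cs = colours₃ a₁ b₁ a₂ b₂ a₃ b₃ in
                X cs ≡ 0# × Y cs ≡ 0# → a₁ ≢ a₂ → b₁ ≢ b₂ → b₃ ≢ b₁ → ⊥
  unsolvable₃ a₁ b₁ a₂ b₂ a₃ b₃ (X≡0 , Y≡0) a₁≢a₂ b₁≢b₂ b₃≢b₁ =
    x*y≢0 (x*y≢0 (x-y≢0 (≢-sym b₃≢b₁)) (x-y≢0 b₁≢b₂)) (x-y≢0 (≢-sym a₁≢a₂)) (trans
      (solve 6 (λ a₁ b₁ a₂ b₂ a₃ b₃ → let cs = colours₃ a₁ b₁ a₂ b₂ a₃ b₃ in
         (b₁ - b₃) * (b₁ - b₂) * (a₂ - a₁) ⊜ 1# * Y cs + (- (b₂ + b₃)) * X cs)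
         refl a₁ b₁ a₂ b₂ a₃ b₃)
      (combination≡0 _ _ Y≡0 X≡0))

  private
    b₂≡b₄-unsolvable : ∀ a₁ b₁ a₂ b₂ a₃ b₃ a₄ → ClosedWalkEquations (colours₄ a₁ b₁ a₂ b₂ a₃ b₃ a₄ b₂) →
                       a₁ ≢ a₂ → b₁ ≢ b₂ → b₁ ≢ b₃ → ⊥
    b₂≡b₄-unsolvable a₁ b₁ a₂ b₂ a₃ b₃ a₄ (X≡0 , Y≡0 , _) a₁≢a₂ b₁≢b₂ b₁≢b₃ =
      x*y≢0 (x*y≢0 (x-y≢0 b₁≢b₃) (x-y≢0 b₁≢b₂)) (x-y≢0 (≢-sym a₁≢a₂)) (trans
        (solve 7 (λ a₁ b₁ a₂ b₂ a₃ b₃ a₄ → let cs = colours₄ a₁ b₁ a₂ b₂ a₃ b₃ a₄ b₂ in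
           (b₁ - b₃) * (b₁ - b₂) * (a₂ - a₁) ⊜ 1# * Y cs + (- (b₃ + b₂)) * X cs)
           refl a₁ b₁ a₂ b₂ a₃ b₃ a₄)
        (combination≡0 _ _ Y≡0 X≡0))

    b₁≡b₃-unsolvable : ∀ a₁ b₁ a₂ b₂ a₃ a₄ b₄ → ClosedWalkEquations (colours₄ a₁ b₁ a₂ b₂ a₃ b₁ a₄ b₄) →
                       a₂ ≢ a₃ → b₁ ≢ b₂ → b₂ ≢ b₄ → ⊥
    b₁≡b₃-unsolvable a₁ b₁ a₂ b₂ a₃ a₄ b₄ (X≡0 , Y≡0 , _) a₂≢a₃ b₁≢b₂ b₂≢b₄ =
      x*y≢0 (x*y≢0 (x-y≢0 (≢-sym b₁≢b₂)) (x-y≢0 b₂≢b₄)) (x-y≢0 (≢-sym a₂≢a₃)) (trans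
        (solve 7 (λ a₁ b₁ a₂ b₂ a₃ a₄ b₄ → let cs = colours₄ a₁ b₁ a₂ b₂ a₃ b₁ a₄ b₄ in
           (b₂ - b₁) * (b₂ - b₄) * (a₃ - a₂) ⊜ 1# * Y cs + (- (b₁ + b₄)) * X cs)
           refl a₁ b₁ a₂ b₂ a₃ a₄ b₄)
        (combination≡0 _ _ Y≡0 X≡0))

    X-alternating : ∀ a₁ b₁ a₂ b₂ a₃ a₄ →
      (b₁ - b₂) * (a₄ - (a₃ + a₁ - a₂)) ≡ X (colours₄ a₁ b₁ a₂ b₂ a₃ b₁ a₄ b₂)
    X-alternating = solve 6 (λ a₁ b₁ a₂ b₂ a₃ a₄ →
      (b₁ - b₂) * (a₄ - (a₃ + a₁ - a₂)) ⊜ X (colours₄ a₁ b₁ a₂ b₂ a₃ b₁ a₄ b₂)) refl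

    ZW-alternating : ∀ a₁ b₁ a₂ b₂ a₃ → let cs = colours₄ a₁ b₁ a₂ b₂ a₃ b₁ (a₃ + a₁ - a₂) b₂ in
      (b₁ - b₂) * (b₁ - b₂) * (a₂ - a₁) * (a₃ - a₂) ≡ (- 1#) * W cs + b₂ * Z cs
    ZW-alternating = solve 5 (λ a₁ b₁ a₂ b₂ a₃ → let cs = colours₄ a₁ b₁ a₂ b₂ a₃ b₁ (a₃ + a₁ - a₂) b₂ in
      (b₁ - b₂) * (b₁ - b₂) * (a₂ - a₁) * (a₃ - a₂) ⊜ (- 1#) * W cs + b₂ * Z cs) refl

    alternating-unsolvable : ∀ a₁ b₁ a₂ b₂ a₃ a₄ → ClosedWalkEquations (colours₄ a₁ b₁ a₂ b₂ a₃ b₁ a₄ b₂) →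
                             a₁ ≢ a₂ → a₂ ≢ a₃ → b₁ ≢ b₂ → ⊥
    alternating-unsolvable a₁ b₁ a₂ b₂ a₃ a₄ (X≡0 , _ , Z≡0 , W≡0) a₁≢a₂ a₂≢a₃ b₁≢b₂ =
      x*y≢0 (x*y≢0 (x*y≢0 (x-y≢0 b₁≢b₂) (x-y≢0 b₁≢b₂)) (x-y≢0 (≢-sym a₁≢a₂))) (x-y≢0 (≢-sym a₂≢a₃))
        (trans (ZW-alternating a₁ b₁ a₂ b₂ a₃) (combination≡0 _ _ (at-a₄ W W≡0) (at-a₄ Z Z≡0)))
      where
      a₄≡ : a₄ ≡ a₃ + a₁ - a₂
      a₄≡ = x-y≡0⇒x≡y (x*y≡0⇒y≡0 (x-y≢0 b₁≢b₂) (trans (X-alternating a₁ b₁ a₂ b₂ a₃ a₄) X≡0))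
      at-a₄ : (P : List (Carrier × Carrier) → Carrier) → P (colours₄ a₁ b₁ a₂ b₂ a₃ b₁ a₄ b₂) ≡ 0# →
              P (colours₄ a₁ b₁ a₂ b₂ a₃ b₁ (a₃ + a₁ - a₂) b₂) ≡ 0#
      at-a₄ P = subst (λ a → P (colours₄ a₁ b₁ a₂ b₂ a₃ b₁ a b₂) ≡ 0#) a₄≡

    scale : ∀ {v u d e w : Carrier} → v * u ≡ 1# → v * d ≡ e * w → d ≡ (e * u) * w
    scale {v} {u} {d} {e} {w} vu≡1 vd≡ew = begin
      d              ≡⟨ solve 1 (λ d → d ⊜ d * 1#) refl d ⟩
      d * 1#         ≡⟨ cong (d *_) vu≡1 ⟨
      d * (v * u)    ≡⟨ solve 3 (λ d v u → d * (v * u) ⊜ u * (v * d)) refl d v u ⟩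
      u * (v * d)    ≡⟨ cong (u *_) vd≡ew ⟩
      u * (e * w)    ≡⟨ solve 3 (λ u e w → u * (e * w) ⊜ (e * u) * w) refl u e w ⟩
      (e * u) * w    ∎
      where open ≡-Reasoning

    x-y≡z⇒x≡y+z : ∀ {x y z : Carrier} → x - y ≡ z → x ≡ y + z
    x-y≡z⇒x≡y+z {x} {y} refl = solve 2 (λ x y → x ⊜ y + (x - y)) refl x y

    V₁Δ₂≡Δ₁V₂ : ∀ a₁ b₁ a₂ b₂ a₃ b₃ a₄ b₄ → let cs = colours₄ a₁ b₁ a₂ b₂ a₃ b₃ a₄ b₄ in
      X cs ≡ 0# → Y cs ≡ 0# → V₁ b₁ b₂ b₃ b₄ * (a₃ - a₂) ≡ (a₂ - a₁) * V₂ b₁ b₂ b₃ b₄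
    V₁Δ₂≡Δ₁V₂ a₁ b₁ a₂ b₂ a₃ b₃ a₄ b₄ X≡0 Y≡0 = x-y≡0⇒x≡y (trans
      (solve 8 (λ a₁ b₁ a₂ b₂ a₃ b₃ a₄ b₄ → let cs = colours₄ a₁ b₁ a₂ b₂ a₃ b₃ a₄ b₄ in
         V₁ b₁ b₂ b₃ b₄ * (a₃ - a₂) - (a₂ - a₁) * V₂ b₁ b₂ b₃ b₄
           ⊜ (- (b₄ - b₃)) * Y cs + ((b₄ - b₃) * (b₃ + b₄)) * X cs)
         refl a₁ b₁ a₂ b₂ a₃ b₃ a₄ b₄)
      (combination≡0 _ _ Y≡0 X≡0))

    V₁Δ₃≡Δ₁V₃ : ∀ a₁ b₁ a₂ b₂ a₃ b₃ a₄ b₄ → let cs = colours₄ a₁ b₁ a₂ b₂ a₃ b₃ a₄ b₄ in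
      X cs ≡ 0# → Y cs ≡ 0# → V₁ b₁ b₂ b₃ b₄ * (a₄ - a₃) ≡ (a₂ - a₁) * V₃ b₁ b₂ b₃ b₄
    V₁Δ₃≡Δ₁V₃ a₁ b₁ a₂ b₂ a₃ b₃ a₄ b₄ X≡0 Y≡0 = x-y≡0⇒x≡y (trans
      (solve 8 (λ a₁ b₁ a₂ b₂ a₃ b₃ a₄ b₄ → let cs = colours₄ a₁ b₁ a₂ b₂ a₃ b₃ a₄ b₄ in
         V₁ b₁ b₂ b₃ b₄ * (a₄ - a₃) - (a₂ - a₁) * V₃ b₁ b₂ b₃ b₄
           ⊜ (b₄ - b₂) * Y cs + (- ((b₄ - b₂) * (b₂ + b₄))) * X cs)
         refl a₁ b₁ a₂ b₂ a₃ b₃ a₄ b₄)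
      (combination≡0 _ _ Y≡0 X≡0))

    vandermonde-kernel : ∀ a₁ b₁ a₂ b₂ a₃ b₃ a₄ b₄ → V₁ b₁ b₂ b₃ b₄ ≢ 0# →
      let cs = colours₄ a₁ b₁ a₂ b₂ a₃ b₃ a₄ b₄ in X cs ≡ 0# → Y cs ≡ 0# →
      ∃[ μ ] (a₂ - a₁ ≡ μ * V₁ b₁ b₂ b₃ b₄) × (a₃ - a₂ ≡ μ * V₂ b₁ b₂ b₃ b₄) × (a₄ - a₃ ≡ μ * V₃ b₁ b₂ b₃ b₄)
    vandermonde-kernel a₁ b₁ a₂ b₂ a₃ b₃ a₄ b₄ V₁≢0 X≡0 Y≡0 with u , V₁u≡1 ← inverse _ V₁≢0 =
        (a₂ - a₁) * u
      , scale V₁u≡1 (solve 2 (λ v d → v * d ⊜ d * v) refl (V₁ b₁ b₂ b₃ b₄) (a₂ - a₁))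
      , scale V₁u≡1 (V₁Δ₂≡Δ₁V₂ a₁ b₁ a₂ b₂ a₃ b₃ a₄ b₄ X≡0 Y≡0)
      , scale V₁u≡1 (V₁Δ₃≡Δ₁V₃ a₁ b₁ a₂ b₂ a₃ b₃ a₄ b₄ X≡0 Y≡0)

    Z-kernelWalk : ∀ a₁ μ b₁ b₂ b₃ b₄ →
      Z (kernelWalk a₁ μ b₁ b₂ b₃ b₄) ≡ μ * μ * vandermonde b₁ b₂ b₃ b₄ * (b₁ - b₂ + b₃ - b₄)
    Z-kernelWalk = solve 6 (λ a₁ μ b₁ b₂ b₃ b₄ →
      Z (  (a₁ , b₁)
         ∷ (a₁ + μ * V₁ b₁ b₂ b₃ b₄ , b₂)
         ∷ (a₁ + μ * V₁ b₁ b₂ b₃ b₄ + μ * V₂ b₁ b₂ b₃ b₄ , b₃)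
         ∷ (a₁ + μ * (V₁ b₁ b₂ b₃ b₄ + V₂ b₁ b₂ b₃ b₄ + V₃ b₁ b₂ b₃ b₄) , b₄)
         ∷ [])
      ⊜ μ * μ * vandermonde b₁ b₂ b₃ b₄ * (b₁ - b₂ + b₃ - b₄)) refl

    W-kernelWalk : ∀ a₁ μ b₁ b₂ b₃ b₄ →
      W (kernelWalk a₁ μ b₁ b₂ b₃ b₄) ≡ μ * μ * vandermonde b₁ b₂ b₃ b₄ * (b₁ * b₃ - b₂ * b₄)
    W-kernelWalk = solve 6 (λ a₁ μ b₁ b₂ b₃ b₄ →
      W (  (a₁ , b₁)
         ∷ (a₁ + μ * V₁ b₁ b₂ b₃ b₄ , b₂)
         ∷ (a₁ + μ * V₁ b₁ b₂ b₃ b₄ + μ * V₂ b₁ b₂ b₃ b₄ , b₃)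
         ∷ (a₁ + μ * (V₁ b₁ b₂ b₃ b₄ + V₂ b₁ b₂ b₃ b₄ + V₃ b₁ b₂ b₃ b₄) , b₄)
         ∷ [])
      ⊜ μ * μ * vandermonde b₁ b₂ b₃ b₄ * (b₁ * b₃ - b₂ * b₄)) refl

    onto-kernelWalk : ∀ {a₁ b₁ a₂ b₂ a₃ b₃ a₄ b₄ μ} (P : List (Carrier × Carrier) → Carrier) →
      a₂ ≡ a₁ + μ * V₁ b₁ b₂ b₃ b₄ →
      a₃ ≡ a₁ + μ * V₁ b₁ b₂ b₃ b₄ + μ * V₂ b₁ b₂ b₃ b₄ →
      a₄ ≡ a₁ + μ * (V₁ b₁ b₂ b₃ b₄ + V₂ b₁ b₂ b₃ b₄ + V₃ b₁ b₂ b₃ b₄) →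
      P (colours₄ a₁ b₁ a₂ b₂ a₃ b₃ a₄ b₄) ≡ 0# → P (kernelWalk a₁ μ b₁ b₂ b₃ b₄) ≡ 0#
    onto-kernelWalk P refl refl refl P≡0 = P≡0

    distinct-unsolvable : ∀ a₁ b₁ a₂ b₂ a₃ b₃ a₄ b₄ → ClosedWalkEquations (colours₄ a₁ b₁ a₂ b₂ a₃ b₃ a₄ b₄) →
      a₁ ≢ a₂ → b₁ ≢ b₂ → b₂ ≢ b₃ → b₃ ≢ b₄ → b₄ ≢ b₁ → b₁ ≢ b₃ → b₂ ≢ b₄ → ⊥
    distinct-unsolvable a₁ b₁ a₂ b₂ a₃ b₃ a₄ b₄ (X≡0 , Y≡0 , Z≡0 , W≡0)
                        a₁≢a₂ b₁≢b₂ b₂≢b₃ b₃≢b₄ b₄≢b₁ b₁≢b₃ b₂≢b₄ =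
      on-kernel (vandermonde-kernel a₁ b₁ a₂ b₂ a₃ b₃ a₄ b₄ V₁≢0 X≡0 Y≡0)
      where
      V₁≢0 : V₁ b₁ b₂ b₃ b₄ ≢ 0#
      V₁≢0 = -x≢0 (x*y≢0 (x*y≢0 (x-y≢0 (≢-sym b₂≢b₃)) (x-y≢0 (≢-sym b₂≢b₄))) (x-y≢0 (≢-sym b₃≢b₄)))

      vandermonde≢0 : vandermonde b₁ b₂ b₃ b₄ ≢ 0#
      vandermonde≢0 =
        x*y≢0 (x*y≢0 (x*y≢0 (x*y≢0 (x*y≢0 (x-y≢0 (≢-sym b₁≢b₂)) (x-y≢0 (≢-sym b₁≢b₃))) (x-y≢0 b₄≢b₁))
          (x-y≢0 (≢-sym b₂≢b₃))) (x-y≢0 (≢-sym b₂≢b₄))) (x-y≢0 (≢-sym b₃≢b₄))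

      on-kernel : ∃[ μ ] (a₂ - a₁ ≡ μ * V₁ b₁ b₂ b₃ b₄) × (a₃ - a₂ ≡ μ * V₂ b₁ b₂ b₃ b₄) ×
                         (a₄ - a₃ ≡ μ * V₃ b₁ b₂ b₃ b₄) → ⊥
      on-kernel (μ , Δ₁ , Δ₂ , Δ₃) =
        x*y≢0 (x-y≢0 (≢-sym b₁≢b₂)) (x-y≢0 b₂≢b₃) (trans
          (solve 4 (λ b₁ b₂ b₃ b₄ →
             (b₂ - b₁) * (b₂ - b₃) ⊜ (- b₂) * (b₁ - b₂ + b₃ - b₄) + 1# * (b₁ * b₃ - b₂ * b₄)) refl b₁ b₂ b₃ b₄)
          (combination≡0 _ _ alternating-sum≡0 cross-products≡0))
        where
        a₂≡ : a₂ ≡ a₁ + μ * V₁ b₁ b₂ b₃ b₄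
        a₂≡ = x-y≡z⇒x≡y+z Δ₁
        a₃≡ : a₃ ≡ a₁ + μ * V₁ b₁ b₂ b₃ b₄ + μ * V₂ b₁ b₂ b₃ b₄
        a₃≡ = trans (x-y≡z⇒x≡y+z Δ₂) (cong (_+ μ * V₂ b₁ b₂ b₃ b₄) a₂≡)
        a₄≡ : a₄ ≡ a₁ + μ * (V₁ b₁ b₂ b₃ b₄ + V₂ b₁ b₂ b₃ b₄ + V₃ b₁ b₂ b₃ b₄)
        a₄≡ = trans (x-y≡z⇒x≡y+z Δ₃) (trans (cong (_+ μ * V₃ b₁ b₂ b₃ b₄) a₃≡)
                (solve 5 (λ a μ v₁ v₂ v₃ → a + μ * v₁ + μ * v₂ + μ * v₃ ⊜ a + μ * (v₁ + v₂ + v₃)) refl _ _ _ _ _))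

        μ≢0 : μ ≢ 0#
        μ≢0 refl = a₁≢a₂ (sym (x-y≡0⇒x≡y (trans Δ₁ (solve 1 (λ v → 0# * v ⊜ 0#) refl _))))

        μμvandermonde≢0 : μ * μ * vandermonde b₁ b₂ b₃ b₄ ≢ 0#
        μμvandermonde≢0 = x*y≢0 (x*y≢0 μ≢0 μ≢0) vandermonde≢0

        alternating-sum≡0 : b₁ - b₂ + b₃ - b₄ ≡ 0#
        alternating-sum≡0 = x*y≡0⇒y≡0 μμvandermonde≢0
          (trans (sym (Z-kernelWalk a₁ μ b₁ b₂ b₃ b₄)) (onto-kernelWalk Z a₂≡ a₃≡ a₄≡ Z≡0))

        cross-products≡0 : b₁ * b₃ - b₂ * b₄ ≡ 0#
        cross-products≡0 = x*y≡0⇒y≡0 μμvandermonde≢0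
          (trans (sym (W-kernelWalk a₁ μ b₁ b₂ b₃ b₄)) (onto-kernelWalk W a₂≡ a₃≡ a₄≡ W≡0))

  unsolvable₄ : ∀ a₁ b₁ a₂ b₂ a₃ b₃ a₄ b₄ → ClosedWalkEquations (colours₄ a₁ b₁ a₂ b₂ a₃ b₃ a₄ b₄) →
                a₁ ≢ a₂ → a₂ ≢ a₃ → b₁ ≢ b₂ → b₂ ≢ b₃ → b₃ ≢ b₄ → b₄ ≢ b₁ → ⊥
  unsolvable₄ a₁ b₁ a₂ b₂ a₃ b₃ a₄ b₄ eqs a₁≢a₂ a₂≢a₃ b₁≢b₂ b₂≢b₃ b₃≢b₄ b₄≢b₁ with b₁ ≟ b₃ | b₂ ≟ b₄
  ... | no b₁≢b₃ | no b₂≢b₄ =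
    distinct-unsolvable a₁ b₁ a₂ b₂ a₃ b₃ a₄ b₄ eqs a₁≢a₂ b₁≢b₂ b₂≢b₃ b₃≢b₄ b₄≢b₁ b₁≢b₃ b₂≢b₄
  ... | no b₁≢b₃ | yes refl = b₂≡b₄-unsolvable a₁ b₁ a₂ b₂ a₃ b₃ a₄ eqs a₁≢a₂ b₁≢b₂ b₁≢b₃
  ... | yes refl | no b₂≢b₄ = b₁≡b₃-unsolvable a₁ b₁ a₂ b₂ a₃ a₄ b₄ eqs a₂≢a₃ b₁≢b₂ b₂≢b₄
  ... | yes refl | yes refl = alternating-unsolvable a₁ b₁ a₂ b₂ a₃ a₄ eqs a₁≢a₂ a₂≢a₃ b₁≢b₂

module ClosedWalks {q : ℕ} (F : FiniteField q) where
  open Field F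
  open Λ₅ F
  open ClosedWalkColours F using (unsolvable₂; unsolvable₃; unsolvable₄)

  noClosedWalk₂ : ∀ {l₁ r₁ l₂ r₂} → Edge l₁ r₁ → Edge l₂ r₁ → Edge l₂ r₂ → Edge l₁ r₂ → l₁ ≢ l₂ → r₁ ≢ r₂ → ⊥
  noClosedWalk₂ {l₁} e₁₁ e₂₁ e₂₂ e₁₂ l₁≢l₂ r₁≢r₂ =
    unsolvable₂ _ _ _ _ (closedWalk₂ l₁ _ _ _ (closes₂ (edges⇒hop e₁₁ e₂₁) (edges⇒hop e₂₂ e₁₂)))
      (l₁≢l₂ ∘ unique-leftNeighbour e₁₁ e₂₁) (r₁≢r₂ ∘ unique-rightNeighbour e₂₁ e₂₂)

  noClosedWalk₃ : ∀ {l₁ r₁ l₂ r₂ l₃ r₃} → Edge l₁ r₁ → Edge l₂ r₁ → Edge l₂ r₂ → Edge l₃ r₂ →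
                  Edge l₃ r₃ → Edge l₁ r₃ → l₁ ≢ l₂ → r₁ ≢ r₂ → r₃ ≢ r₁ → ⊥
  noClosedWalk₃ {l₁} e₁₁ e₂₁ e₂₂ e₃₂ e₃₃ e₁₃ l₁≢l₂ r₁≢r₂ r₃≢r₁ =
    unsolvable₃ _ _ _ _ _ _
      (closedWalk₃ l₁ _ _ _ _ _ (closes₃ (edges⇒hop e₁₁ e₂₁) (edges⇒hop e₂₂ e₃₂) (edges⇒hop e₃₃ e₁₃)))
      (l₁≢l₂ ∘ unique-leftNeighbour e₁₁ e₂₁) (r₁≢r₂ ∘ unique-rightNeighbour e₂₁ e₂₂)
      (r₃≢r₁ ∘ unique-rightNeighbour e₁₃ e₁₁)

  noClosedWalk₄ : ∀ {l₁ r₁ l₂ r₂ l₃ r₃ l₄ r₄} → Edge l₁ r₁ → Edge l₂ r₁ → Edge l₂ r₂ → Edge l₃ r₂ →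
                  Edge l₃ r₃ → Edge l₄ r₃ → Edge l₄ r₄ → Edge l₁ r₄ →
                  l₁ ≢ l₂ → l₂ ≢ l₃ → r₁ ≢ r₂ → r₂ ≢ r₃ → r₃ ≢ r₄ → r₄ ≢ r₁ → ⊥
  noClosedWalk₄ {l₁} e₁₁ e₂₁ e₂₂ e₃₂ e₃₃ e₄₃ e₄₄ e₁₄ l₁≢l₂ l₂≢l₃ r₁≢r₂ r₂≢r₃ r₃≢r₄ r₄≢r₁ =
    unsolvable₄ _ _ _ _ _ _ _ _
      (closedWalk₄ l₁ _ _ _ _ _ _ _
        (closes₄ (edges⇒hop e₁₁ e₂₁) (edges⇒hop e₂₂ e₃₂) (edges⇒hop e₃₃ e₄₃) (edges⇒hop e₄₄ e₁₄)))
      (l₁≢l₂ ∘ unique-leftNeighbour e₁₁ e₂₁) (l₂≢l₃ ∘ unique-leftNeighbour e₂₂ e₃₂)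
      (r₁≢r₂ ∘ unique-rightNeighbour e₂₁ e₂₂) (r₂≢r₃ ∘ unique-rightNeighbour e₃₂ e₃₃)
      (r₃≢r₄ ∘ unique-rightNeighbour e₄₃ e₄₄) (r₄≢r₁ ∘ unique-rightNeighbour e₁₄ e₁₁)

-- Closed walks of length 10 over F₃

module _ {A : Set} {{_ : RingOperations A}} where

  -- Over F₃, where x² = 1 for x ≠ 0, this is 1 if b = β and 0 otherwise.
  indicator : A → A → A
  indicator β b = 1# - (b - β) * (b - β)

  indicatorSum : List (A × A) → A
  indicatorSum []                    = 0#
  indicatorSum cs@((a₁ , b₁) ∷ _) = sumOver (steps cs) λ a b a′ → indicator b₁ b * (indicator a₁ a′ - indicator a₁ a)

module FieldOfThree (F : FiniteField 3) where
  open Field F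
  open ClosedWalkColours F using (ClosedWalkEquations)

  1+1≢0 : 1# + 1# ≢ (Carrier ∋ 0#)
  1+1≢0 1+1≡0 with u , u∉ ← ∃∉ (0# ∷ 1# ∷ []) (s≤s (s≤s (s≤s z≤n))) =
    contradiction (unique⇒≤ 0,1,u,u+1-distinct) (n≮n 3)
    where
    u≢0 : u ≢ 0#
    u≢0 = u∉ ∘ here
    u≢1 : u ≢ 1#
    u≢1 = u∉ ∘ there ∘ here
    0≢u+1 : 0# ≢ u + 1#
    0≢u+1 0≡u+1 = u≢1 (begin
      u                          ≡⟨ solve 1 (λ u → u ⊜ (u + 1#) + 1# - (1# + 1#)) refl u ⟩
      (u + 1#) + 1# - (1# + 1#)  ≡⟨ cong₂ (λ s t → s + 1# - t) (sym 0≡u+1) 1+1≡0 ⟩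
      0# + 1# - 0#               ≡⟨ solve 0 (0# + 1# - 0# ⊜ 1#) refl ⟩
      1#                         ∎)
      where open ≡-Reasoning
    0,1,u,u+1-distinct : Unique (0# ∷ 1# ∷ u ∷ u + 1# ∷ [])
    0,1,u,u+1-distinct =
      (0≢1 ∷ ≢-sym u≢0 ∷ 0≢u+1 ∷ []) ∷ (≢-sym u≢1 ∷ x≢0⇒1≢x+1 u≢0 ∷ []) ∷ (x≢x+1 u ∷ []) ∷ [] ∷ []

  private
    0,1,-1-distinct : Unique (0# ∷ 1# ∷ - 1# ∷ [])
    0,1,-1-distinct = (0≢1 ∷ ≢-sym (-x≢0 1≢0) ∷ []) ∷ (1≢-1 ∷ []) ∷ [] ∷ []
      where
      1≢-1 : 1# ≢ - 1#
      1≢-1 1≡-1 = 1+1≢0 (trans (cong (1# +_) 1≡-1) (solve 0 (1# + - 1# ⊜ 0#) refl))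

    square-of-element : ∀ {x} → x ∈ (0# ∷ 1# ∷ - 1# ∷ []) → x ≢ 0# → x * x ≡ 1#
    square-of-element (here refl)                 x≢0 = contradiction refl x≢0
    square-of-element (there (here refl))         _   = solve 0 (1# * 1# ⊜ 1#) refl
    square-of-element (there (there (here refl))) _   = solve 0 ((- 1#) * (- 1#) ⊜ 1#) refl

  x≢0⇒x*x≡1 : ∀ {x} → x ≢ 0# → x * x ≡ 1#
  x≢0⇒x*x≡1 {x} = square-of-element (unique-full⇒∈ 0,1,-1-distinct x)

  private
    indicator-certificate : ∀ a₁ b₁ a₂ b₂ a₃ b₃ a₄ b₄ a₅ b₅ → let cs = colours₅ a₁ b₁ a₂ b₂ a₃ b₃ a₄ b₄ a₅ b₅ in
      indicatorSum cs ≡ ((1# + 1#) * (1# + 1#) * a₁ * b₁ - X cs) * X cs + (- ((1# + 1#) * a₁)) * Y cs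
                        + (- ((1# + 1#) * b₁)) * Z cs + (1# + 1#) * W cs
    indicator-certificate = solve 10 (λ a₁ b₁ a₂ b₂ a₃ b₃ a₄ b₄ a₅ b₅ →
      indicatorSum (colours₅ a₁ b₁ a₂ b₂ a₃ b₃ a₄ b₄ a₅ b₅) ⊜
          ((1# + 1#) * (1# + 1#) * a₁ * b₁ - X (colours₅ a₁ b₁ a₂ b₂ a₃ b₃ a₄ b₄ a₅ b₅))
            * X (colours₅ a₁ b₁ a₂ b₂ a₃ b₃ a₄ b₄ a₅ b₅)
        + (- ((1# + 1#) * a₁)) * Y (colours₅ a₁ b₁ a₂ b₂ a₃ b₃ a₄ b₄ a₅ b₅)
        + (- ((1# + 1#) * b₁)) * Z (colours₅ a₁ b₁ a₂ b₂ a₃ b₃ a₄ b₄ a₅ b₅)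
        + (1# + 1#) * W (colours₅ a₁ b₁ a₂ b₂ a₃ b₃ a₄ b₄ a₅ b₅)) refl

    combination₄≡0 : ∀ {P Q R S : Carrier} s t u v → P ≡ 0# → Q ≡ 0# → R ≡ 0# → S ≡ 0# →
                     s * P + t * Q + u * R + v * S ≡ 0#
    combination₄≡0 s t u v refl refl refl refl =
      solve 4 (λ s t u v → s * 0# + t * 0# + u * 0# + v * 0# ⊜ 0#) refl s t u v

    indicator-vanishes : ∀ {β b} → b ≢ β → indicator β b ≡ 0#
    indicator-vanishes {β} {b} b≢β = trans (cong (λ s → 1# - s) (x≢0⇒x*x≡1 (x-y≢0 b≢β))) (x-x≡0 1#)

    indicator-diagonal : ∀ β → indicator β β ≡ 1#
    indicator-diagonal = solve 1 (λ β → indicator β β ⊜ 1#) refl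

    only-first-term : ∀ {g₂ g₃ g₄ g₅} (g₁ d₁ d₂ d₃ d₄ d₅ : Carrier) →
                      g₂ ≡ 0# → g₃ ≡ 0# → g₄ ≡ 0# → g₅ ≡ 0# →
                      g₁ * d₁ + (g₂ * d₂ + (g₃ * d₃ + (g₄ * d₄ + (g₅ * d₅ + 0#)))) ≡ g₁ * d₁
    only-first-term g₁ d₁ d₂ d₃ d₄ d₅ refl refl refl refl = solve 6 (λ g₁ d₁ d₂ d₃ d₄ d₅ →
      g₁ * d₁ + (0# * d₂ + (0# * d₃ + (0# * d₄ + (0# * d₅ + 0#)))) ⊜ g₁ * d₁) refl g₁ d₁ d₂ d₃ d₄ d₅

  unique-colour-unsolvable : ∀ a₁ b₁ a₂ b₂ a₃ b₃ a₄ b₄ a₅ b₅ →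
    ClosedWalkEquations (colours₅ a₁ b₁ a₂ b₂ a₃ b₃ a₄ b₄ a₅ b₅) →
    a₂ ≢ a₁ → b₂ ≢ b₁ → b₃ ≢ b₁ → b₄ ≢ b₁ → b₅ ≢ b₁ → ⊥
  unique-colour-unsolvable a₁ b₁ a₂ b₂ a₃ b₃ a₄ b₄ a₅ b₅ (X≡0 , Y≡0 , Z≡0 , W≡0) a₂≢a₁ b₂≢b₁ b₃≢b₁ b₄≢b₁ b₅≢b₁ =
    -x≢0 1≢0 (begin
      - 1#
        ≡⟨ solve 0 (- 1# ⊜ 1# * (0# - 1#)) refl ⟩
      1# * (0# - 1#)
        ≡⟨ cong₂ (λ g d → g * (d - 1#)) (indicator-diagonal b₁) (indicator-vanishes a₂≢a₁) ⟨
      indicator b₁ b₁ * (indicator a₁ a₂ - 1#)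
        ≡⟨ cong (λ d → indicator b₁ b₁ * (indicator a₁ a₂ - d)) (indicator-diagonal a₁) ⟨
      indicator b₁ b₁ * (indicator a₁ a₂ - indicator a₁ a₁)
        ≡⟨ only-first-term _ _ _ _ _ _ (indicator-vanishes b₂≢b₁) (indicator-vanishes b₃≢b₁)
                                       (indicator-vanishes b₄≢b₁) (indicator-vanishes b₅≢b₁) ⟨
      indicatorSum (colours₅ a₁ b₁ a₂ b₂ a₃ b₃ a₄ b₄ a₅ b₅)
        ≡⟨ indicator-certificate a₁ b₁ a₂ b₂ a₃ b₃ a₄ b₄ a₅ b₅ ⟩
      _
        ≡⟨ combination₄≡0 _ _ _ _ X≡0 Y≡0 Z≡0 W≡0 ⟩
      0#
        ∎)
    where open ≡-Reasoning

  -- Consecutive colours differ, so each colour of F₃ occurs at most twice among b₁, …, b₅ and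
  -- one occurs exactly once; the case split finds it and rotates the walk to start there.
  unsolvable₅ : ∀ a₁ b₁ a₂ b₂ a₃ b₃ a₄ b₄ a₅ b₅ →
    ClosedWalkEquations (colours₅ a₁ b₁ a₂ b₂ a₃ b₃ a₄ b₄ a₅ b₅) →
    ClosedWalkEquations (colours₅ a₂ b₂ a₃ b₃ a₄ b₄ a₅ b₅ a₁ b₁) →
    ClosedWalkEquations (colours₅ a₃ b₃ a₄ b₄ a₅ b₅ a₁ b₁ a₂ b₂) →
    ClosedWalkEquations (colours₅ a₄ b₄ a₅ b₅ a₁ b₁ a₂ b₂ a₃ b₃) →
    ClosedWalkEquations (colours₅ a₅ b₅ a₁ b₁ a₂ b₂ a₃ b₃ a₄ b₄) →
    a₁ ≢ a₂ → a₂ ≢ a₃ → a₃ ≢ a₄ → a₄ ≢ a₅ → a₅ ≢ a₁ →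
    b₁ ≢ b₂ → b₂ ≢ b₃ → b₃ ≢ b₄ → b₄ ≢ b₅ → b₅ ≢ b₁ → ⊥
  unsolvable₅ a₁ b₁ a₂ b₂ a₃ b₃ a₄ b₄ a₅ b₅ eqs₁ eqs₂ eqs₃ eqs₄ eqs₅
              a₁≢a₂ a₂≢a₃ a₃≢a₄ a₄≢a₅ a₅≢a₁ b₁≢b₂ b₂≢b₃ b₃≢b₄ b₄≢b₅ b₅≢b₁
    with b₁ ≟ b₃ | b₁ ≟ b₄
  ... | no b₁≢b₃ | no b₁≢b₄ =
    unique-colour-unsolvable a₁ b₁ a₂ b₂ a₃ b₃ a₄ b₄ a₅ b₅ eqs₁
      (≢-sym a₁≢a₂) (≢-sym b₁≢b₂) (≢-sym b₁≢b₃) (≢-sym b₁≢b₄) b₅≢b₁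
  ... | yes refl | _ with b₂ ≟ b₄
  ...   | no b₂≢b₄ =
    unique-colour-unsolvable a₄ b₄ a₅ b₅ a₁ b₁ a₂ b₂ a₃ b₃ eqs₄ (≢-sym a₄≢a₅) (≢-sym b₄≢b₅) b₃≢b₄ b₂≢b₄ b₃≢b₄
  ...   | yes refl =
    unique-colour-unsolvable a₅ b₅ a₁ b₁ a₂ b₂ a₃ b₃ a₄ b₄ eqs₅ (≢-sym a₅≢a₁) (≢-sym b₅≢b₁) b₄≢b₅ (≢-sym b₅≢b₁) b₄≢b₅
  unsolvable₅ a₁ b₁ a₂ b₂ a₃ b₃ a₄ b₄ a₅ b₅ eqs₁ eqs₂ eqs₃ eqs₄ eqs₅
              a₁≢a₂ a₂≢a₃ a₃≢a₄ a₄≢a₅ a₅≢a₁ b₁≢b₂ b₂≢b₃ b₃≢b₄ b₄≢b₅ b₅≢b₁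
    | no b₁≢b₃ | yes refl with b₃ ≟ b₅
  ...   | no b₃≢b₅ =
    unique-colour-unsolvable a₃ b₃ a₄ b₄ a₅ b₅ a₁ b₁ a₂ b₂ eqs₃ (≢-sym a₃≢a₄) (≢-sym b₃≢b₄) (≢-sym b₃≢b₅) b₁≢b₃ b₂≢b₃
  ...   | yes refl =
    unique-colour-unsolvable a₂ b₂ a₃ b₃ a₄ b₄ a₅ b₅ a₁ b₁ eqs₂ (≢-sym a₂≢a₃) (≢-sym b₂≢b₃) b₁≢b₂ (≢-sym b₂≢b₃) b₁≢b₂

module ClosedWalksOverThree (F : FiniteField 3) where
  open Field F
  open Λ₅ F
  open FieldOfThree F using (unsolvable₅)

  noClosedWalk₅ : ∀ {l₁ r₁ l₂ r₂ l₃ r₃ l₄ r₄ l₅ r₅} → Edge l₁ r₁ → Edge l₂ r₁ → Edge l₂ r₂ → Edge l₃ r₂ →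
                  Edge l₃ r₃ → Edge l₄ r₃ → Edge l₄ r₄ → Edge l₅ r₄ → Edge l₅ r₅ → Edge l₁ r₅ →
                  l₁ ≢ l₂ → l₂ ≢ l₃ → l₃ ≢ l₄ → l₄ ≢ l₅ → l₅ ≢ l₁ →
                  r₁ ≢ r₂ → r₂ ≢ r₃ → r₃ ≢ r₄ → r₄ ≢ r₅ → r₅ ≢ r₁ → ⊥
  noClosedWalk₅ {l₁} {r₁} {l₂} {r₂} {l₃} {r₃} {l₄} {r₄} {l₅} {r₅} e₁₁ e₂₁ e₂₂ e₃₂ e₃₃ e₄₃ e₄₄ e₅₄ e₅₅ e₁₅
                l₁≢l₂ l₂≢l₃ l₃≢l₄ l₄≢l₅ l₅≢l₁ r₁≢r₂ r₂≢r₃ r₃≢r₄ r₄≢r₅ r₅≢r₁ =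
    unsolvable₅ _ _ _ _ _ _ _ _ _ _
      (closedWalk₅ l₁ _ _ _ _ _ _ _ _ _ (closes₅ h₁ h₂ h₃ h₄ h₅))
      (closedWalk₅ l₂ _ _ _ _ _ _ _ _ _ (closes₅ h₂ h₃ h₄ h₅ h₁))
      (closedWalk₅ l₃ _ _ _ _ _ _ _ _ _ (closes₅ h₃ h₄ h₅ h₁ h₂))
      (closedWalk₅ l₄ _ _ _ _ _ _ _ _ _ (closes₅ h₄ h₅ h₁ h₂ h₃))
      (closedWalk₅ l₅ _ _ _ _ _ _ _ _ _ (closes₅ h₅ h₁ h₂ h₃ h₄))
      (l₁≢l₂ ∘ unique-leftNeighbour e₁₁ e₂₁) (l₂≢l₃ ∘ unique-leftNeighbour e₂₂ e₃₂)
      (l₃≢l₄ ∘ unique-leftNeighbour e₃₃ e₄₃) (l₄≢l₅ ∘ unique-leftNeighbour e₄₄ e₅₄)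
      (l₅≢l₁ ∘ unique-leftNeighbour e₅₅ e₁₅)
      (r₁≢r₂ ∘ unique-rightNeighbour e₂₁ e₂₂) (r₂≢r₃ ∘ unique-rightNeighbour e₃₂ e₃₃)
      (r₃≢r₄ ∘ unique-rightNeighbour e₄₃ e₄₄) (r₄≢r₅ ∘ unique-rightNeighbour e₅₄ e₅₅)
      (r₅≢r₁ ∘ unique-rightNeighbour e₁₅ e₁₁)
    where
    h₁ : l₂ ≡ hop l₁ (head r₁) (head l₂)
    h₁ = edges⇒hop e₁₁ e₂₁
    h₂ : l₃ ≡ hop l₂ (head r₂) (head l₃)
    h₂ = edges⇒hop e₂₂ e₃₂
    h₃ : l₄ ≡ hop l₃ (head r₃) (head l₄)
    h₃ = edges⇒hop e₃₃ e₄₃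
    h₄ : l₅ ≡ hop l₄ (head r₄) (head l₅)
    h₄ = edges⇒hop e₄₄ e₅₄
    h₅ : l₁ ≡ hop l₅ (head r₅) (head l₁)
    h₅ = edges⇒hop e₅₅ e₁₅

-- Cycles of Λ₅

module _ {A : Set} {{_ : RingOperations A}} where

  origin : Vec A 6
  origin = 0# ∷ 0# ∷ 0# ∷ 0# ∷ 0# ∷ 0# ∷ []

  -- A closed walk of length 10 from the origin; c ∉ {0, 1, −1} keeps its vertices apart.
  tenCycleColours : A → List (A × A)
  tenCycleColours c = (0# , 0#) ∷ (1# , c + 1#) ∷ (c , 0#) ∷ (0# , 1#) ∷ (c + 1# , c) ∷ []

  tenCycleVertices : A → Vec (Side × Vec A 6) 10
  tenCycleVertices c =
    (left , l₁) ∷ (right , r₁) ∷ (left , l₂) ∷ (right , r₂) ∷ (left , l₃) ∷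
    (right , r₃) ∷ (left , l₄) ∷ (right , r₄) ∷ (left , l₅) ∷ (right , r₅) ∷ []
    where
    l₁ r₁ l₂ r₂ l₃ r₃ l₄ r₄ l₅ r₅ : Vec A 6
    l₁ = origin
    r₁ = rightNeighbour l₁ 0#
    l₂ = leftNeighbour r₁ 1#
    r₂ = rightNeighbour l₂ (c + 1#)
    l₃ = leftNeighbour r₂ c
    r₃ = rightNeighbour l₃ 0#
    l₄ = leftNeighbour r₃ 0#
    r₄ = rightNeighbour l₄ 1#
    l₅ = leftNeighbour r₄ (c + 1#)
    r₅ = rightNeighbour l₅ c

module Λ₅Cycles {q : ℕ} (F : FiniteField q) where
  open Field F
  open Λ₅ F
  open ClosedWalks F

  side-alternates : ∀ {u w} → ΛAdj F 5 2≤5 u w → proj₁ w ≡ flip (proj₁ u)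
  side-alternates {left  , _} {right , _} _ = refl
  side-alternates {right , _} {left  , _} _ = refl

  open Bipartite {Λ F 5 2≤5} proj₁ side-alternates public

  module LeftStart {n} (c : Cycle (Λ F 5 2≤5) n) (start : proj₁ (Cycle.vertex c zero) ≡ left) where
    open Cycle c

    vec : Fin (suc m) → Vec Carrier 6
    vec i = proj₂ (vertex i)

    located : ∀ i → vertex i ≡ (flips (toℕ i) left , vec i)
    located i = cong (_, vec i) (trans (side-along-path vertex step i) (cong (flips (toℕ i)) start))

    edge : ∀ i → ΛAdj F 5 2≤5 (flips (toℕ (inject₁ i)) left , vec (inject₁ i))
                              (flips (suc (toℕ i)) left , vec (suc i))
    edge i = subst₂ (ΛAdj F 5 2≤5) (located (inject₁ i)) (located (suc i)) (step i)

    closing : ΛAdj F 5 2≤5 (flips (toℕ (fromℕ m)) left , vec (fromℕ m)) (left , vec zero)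
    closing = subst₂ (ΛAdj F 5 2≤5) (located (fromℕ m)) (located zero) close

    apart : ∀ i j {i≢j : False (i Fin.≟ j)} → flips (toℕ i) left ≡ flips (toℕ j) left → vec i ≢ vec j
    apart i j {i≢j} same vi≡vj =
      toWitnessFalse i≢j (distinct i j (trans (located i) (trans (cong₂ _,_ same vi≡vj) (sym (located j)))))

  noCycle₄ : ¬ Cycle (Λ F 5 2≤5) 4
  noCycle₄ = noCycle-fromLeft λ where
    c@record { n≡1+m = refl } start → let open LeftStart c start in
      noClosedWalk₂ (edge (# 0)) (edge (# 1)) (edge (# 2)) closing
        (apart (# 0) (# 2) refl) (apart (# 1) (# 3) refl)

  noCycle₆ : ¬ Cycle (Λ F 5 2≤5) 6
  noCycle₆ = noCycle-fromLeft λ where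
    c@record { n≡1+m = refl } start → let open LeftStart c start in
      noClosedWalk₃ (edge (# 0)) (edge (# 1)) (edge (# 2)) (edge (# 3)) (edge (# 4)) closing
        (apart (# 0) (# 2) refl) (apart (# 1) (# 3) refl) (apart (# 5) (# 1) refl)

  noCycle₈ : ¬ Cycle (Λ F 5 2≤5) 8
  noCycle₈ = noCycle-fromLeft λ where
    c@record { n≡1+m = refl } start → let open LeftStart c start in
      noClosedWalk₄ (edge (# 0)) (edge (# 1)) (edge (# 2)) (edge (# 3)) (edge (# 4)) (edge (# 5)) (edge (# 6)) closing
        (apart (# 0) (# 2) refl) (apart (# 2) (# 4) refl)
        (apart (# 1) (# 3) refl) (apart (# 3) (# 5) refl) (apart (# 5) (# 7) refl) (apart (# 7) (# 1) refl)

  girth≥10 : GirthAtLeast (Λ F 5 2≤5) 10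
  girth≥10 =
    girth-step (girth-step (girth-step (girth-step (girth-step (girth-step (girth-step girth≥3
      (noOddCycle 1)) noCycle₄) (noOddCycle 2)) noCycle₆) (noOddCycle 3)) noCycle₈) (noOddCycle 4)

module Λ₅CyclesOverThree (F : FiniteField 3) where
  open Λ₅ F using (2≤5)
  open Λ₅Cycles F
  open ClosedWalksOverThree F

  noCycle₁₀ : ¬ Cycle (Λ F 5 2≤5) 10
  noCycle₁₀ = noCycle-fromLeft λ where
    c@record { n≡1+m = refl } start → let open LeftStart c start in
      noClosedWalk₅ (edge (# 0)) (edge (# 1)) (edge (# 2)) (edge (# 3)) (edge (# 4))
                    (edge (# 5)) (edge (# 6)) (edge (# 7)) (edge (# 8)) closing
        (apart (# 0) (# 2) refl) (apart (# 2) (# 4) refl) (apart (# 4) (# 6) refl)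
        (apart (# 6) (# 8) refl) (apart (# 8) (# 0) refl)
        (apart (# 1) (# 3) refl) (apart (# 3) (# 5) refl) (apart (# 5) (# 7) refl)
        (apart (# 7) (# 9) refl) (apart (# 9) (# 1) refl)

  girth≥12 : GirthAtLeast (Λ F 5 2≤5) 12
  girth≥12 = girth-step (girth-step girth≥10 noCycle₁₀) (noOddCycle 5)

module TenCycle {q : ℕ} (F : FiniteField q) where
  open Field F
  open Λ₅ F

  private
    vec6-≡ : ∀ {x₀ x₁ x₂ x₃ x₄ x₅ y₀ y₁ y₂ y₃ y₄ y₅ : Carrier} →
             x₀ ≡ y₀ → x₁ ≡ y₁ → x₂ ≡ y₂ → x₃ ≡ y₃ → x₄ ≡ y₄ → x₅ ≡ y₅ →
             _≡_ {A = Vec Carrier 6} (x₀ ∷ x₁ ∷ x₂ ∷ x₃ ∷ x₄ ∷ x₅ ∷ []) (y₀ ∷ y₁ ∷ y₂ ∷ y₃ ∷ y₄ ∷ y₅ ∷ [])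
    vec6-≡ refl refl refl refl refl refl = refl

  tenCycle-closes : ∀ c → walk origin (tenCycleColours c) ≡ origin
  tenCycle-closes c = vec6-≡ refl
    (solve 1 (λ c → lookup (walk origin (tenCycleColours c)) (# 1) ⊜ 0#) refl c)
    (solve 1 (λ c → lookup (walk origin (tenCycleColours c)) (# 2) ⊜ 0#) refl c)
    (solve 1 (λ c → lookup (walk origin (tenCycleColours c)) (# 3) ⊜ 0#) refl c)
    (solve 1 (λ c → lookup (walk origin (tenCycleColours c)) (# 4) ⊜ 0#) refl c)
    (solve 1 (λ c → lookup (walk origin (tenCycleColours c)) (# 5) ⊜ 0#) refl c)

  private
    L≢R : ∀ {u v : Vec Carrier 6} → _≢_ {A = Side × Vec Carrier 6} (left , u) (right , v)
    L≢R ()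

    R≢L : ∀ {u v : Vec Carrier 6} → _≢_ {A = Side × Vec Carrier 6} (right , u) (left , v)
    R≢L ()

    by-colour : ∀ {s : Side} {u v : Vec Carrier 6} → head u ≢ head v → (s , u) ≢ (s , v)
    by-colour colours≢ = colours≢ ∘ cong (head ∘ proj₂)

    by-coordinate : ∀ {s : Side} {u v : Vec Carrier 6} i → lookup u i - lookup v i ≢ 0# → (s , u) ≢ (s , v)
    by-coordinate {u = u} i difference≢0 refl = difference≢0 (x-x≡0 (lookup u i))

  tenCycle : ∀ c → c ≢ 0# → c ≢ 1# → c ≢ - 1# → Cycle (Λ F 5 2≤5) 10
  tenCycle c c≢0 c≢1 c≢-1 = record
    { m = 9 ; n≡1+m = refl ; 3≤n = s≤s (s≤s (s≤s z≤n))
    ; vertex   = vertex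
    ; distinct = lookup-injective vertices-distinct
    ; step     = step
    ; close    = subst (λ l → Edge l (proj₂ (vertex (# 9)))) (tenCycle-closes c) (leftNeighbour-edge 0# refl)
    }
    where
    vertex : Fin 10 → Side × Vec Carrier 6
    vertex = lookup (tenCycleVertices c)

    step : ∀ (i : Fin 9) → ΛAdj F 5 2≤5 (vertex (inject₁ i)) (vertex (suc i))
    step zero                                                 = rightNeighbour-edge _ refl
    step (suc zero)                                           = leftNeighbour-edge _ refl
    step (suc (suc zero))                                     = rightNeighbour-edge _ refl
    step (suc (suc (suc zero)))                               = leftNeighbour-edge _ refl
    step (suc (suc (suc (suc zero))))                         = rightNeighbour-edge _ refl
    step (suc (suc (suc (suc (suc zero)))))                   = leftNeighbour-edge _ refl
    step (suc (suc (suc (suc (suc (suc zero))))))             = rightNeighbour-edge _ refl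
    step (suc (suc (suc (suc (suc (suc (suc zero)))))))       = leftNeighbour-edge _ refl
    step (suc (suc (suc (suc (suc (suc (suc (suc zero)))))))) = rightNeighbour-edge _ refl

    0≢c : 0# ≢ c
    0≢c = ≢-sym c≢0
    1≢c : 1# ≢ c
    1≢c = ≢-sym c≢1
    c+1≢0 : c + 1# ≢ 0#
    c+1≢0 = x≢-1⇒x+1≢0 c≢-1
    0≢c+1 : 0# ≢ c + 1#
    0≢c+1 = ≢-sym c+1≢0
    1≢c+1 : 1# ≢ c + 1#
    1≢c+1 = x≢0⇒1≢x+1 c≢0
    c≢c+1 : c ≢ c + 1#
    c≢c+1 = x≢x+1 c

    l₁≢l₄ : vertex (# 0) ≢ vertex (# 6)
    l₁≢l₄ = by-coordinate (# 1) (subst (_≢ 0#)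
      (solve 1 (λ c → (1# - c) * (c + 1#) ⊜ lookup (proj₂ (lookup (tenCycleVertices c) (# 0))) (# 1)
                                             - lookup (proj₂ (lookup (tenCycleVertices c) (# 6))) (# 1)) refl c)
      (x*y≢0 (x-y≢0 1≢c) c+1≢0))

    r₁≢r₃ : vertex (# 1) ≢ vertex (# 5)
    r₁≢r₃ = by-coordinate (# 2) (subst (_≢ 0#)
      (solve 1 (λ c → (c - 1#) * (c + 1#) ⊜ lookup (proj₂ (lookup (tenCycleVertices c) (# 1))) (# 2)
                                             - lookup (proj₂ (lookup (tenCycleVertices c) (# 5))) (# 2)) refl c)
      (x*y≢0 (x-y≢0 c≢1) c+1≢0))

    vertices-distinct : Unique (tenCycleVertices c)
    vertices-distinct =
        (L≢R ∷ by-colour 0≢1 ∷ L≢R ∷ by-colour 0≢c ∷ L≢R ∷ l₁≢l₄ ∷ L≢R ∷ by-colour 0≢c+1 ∷ L≢R ∷ [])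
      ∷ (R≢L ∷ by-colour 0≢c+1 ∷ R≢L ∷ r₁≢r₃ ∷ R≢L ∷ by-colour 0≢1 ∷ R≢L ∷ by-colour 0≢c ∷ [])
      ∷ (L≢R ∷ by-colour 1≢c ∷ L≢R ∷ by-colour 1≢0 ∷ L≢R ∷ by-colour 1≢c+1 ∷ L≢R ∷ [])
      ∷ (R≢L ∷ by-colour c+1≢0 ∷ R≢L ∷ by-colour (≢-sym 1≢c+1) ∷ R≢L ∷ by-colour (≢-sym c≢c+1) ∷ [])
      ∷ (L≢R ∷ by-colour c≢0 ∷ L≢R ∷ by-colour c≢c+1 ∷ L≢R ∷ [])
      ∷ (R≢L ∷ by-colour 0≢1 ∷ R≢L ∷ by-colour 0≢c ∷ [])
      ∷ (L≢R ∷ by-colour 0≢c+1 ∷ L≢R ∷ [])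
      ∷ (R≢L ∷ by-colour 1≢c ∷ [])
      ∷ (L≢R ∷ [])
      ∷ [] ∷ []

  girth≡10 : 3 < q → GirthIs (Λ F 5 2≤5) 10
  girth≡10 3<q with c , c∉ ← ∃∉ (0# ∷ 1# ∷ - 1# ∷ []) 3<q =
    tenCycle c (c∉ ∘ here) (c∉ ∘ there ∘ here) (c∉ ∘ there ∘ there ∘ here) , Λ₅Cycles.girth≥10 F

corollary1 : ((q : ℕ) → IsPrimePower q → 3 < q → (F : FiniteField q) →
    GirthIs (Λ F 5 (s≤s (s≤s z≤n))) 10)
    × ((F : FiniteField 3) → GirthAtLeast (Λ F 5 (s≤s (s≤s z≤n))) 12)
corollary1 = (λ q _ 3<q F → TenCycle.girth≡10 F 3<q) , Λ₅CyclesOverThree.girth≥12
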